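{- Let $k\ge2$ and let $f:\mathbb{F}_{2^{2k-1}}\to\mathbb{F}_{2^{2k-1}}$, $f(x)=x^{2^k-1}+x^{2^k}$. Then $f$ is a 2-to-1 APN function on $\mathbb{F}_{2^{2k-1}}$, and its image is a $(2^{2k-2},2,2^{2k-2},2^{2k-3})$ relative difference set in $(\mathbb{F}_{2^{2k-1}},+)$ relative to the subgroup $N=\{0,1\}$.
   Context: A function $F:\mathbb{F}_{2^r}\to\mathbb{F}_{2^r}$ is APN (almost perfect nonlinear) if for every $a\ne0$ and every $b$ the equation $F(x+a)-F(x)=b$ has at most 2 solutions $x\in\mathbb{F}_{2^r}$. It is 2-to-1 if every element of its image has exactly two preimages. Let $G$ be a finite group of order $mn'$ with a normal subgroup $N$ of order $n'$. A $k'$-subset $R\subseteq G$ is an $(m,n',k',\lambda)$ relative difference set relative to $N$ if the list of differences $r-r'$ with $r,r'\in R$, $r\ne r'$, covers every element of $G\setminus N$ exactly $\lambda$ times and covers no element of $N\setminus\{0\}$. -}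

module Defs where

open import Level using (0ℓ)
open import Data.Nat as ℕ using (ℕ; zero; suc)
open import Data.Fin as Fin using (Fin)
open import Data.Fin.Properties as FinP using ()
open import Data.Product using (Σ; ∃; _×_; _,_; proj₁; proj₂)
open import Data.Sum using (_⊎_)
open import Data.List using (List; length; filter; map; allFin; cartesianProduct)
open import Data.List.Relation.Unary.Any as Any using (Any; any?)
open import Data.List.Membership.Propositional using (_∈_; lose)
open import Data.List.Membership.Propositional.Properties using (∈-allFin; ∈-map⁺)
open import Relation.Nullary using (¬_; Dec; yes; no)
open import Relation.Nullary.Decidable using (map′; _×-dec_; ¬?)
open import Relation.Unary using (Pred; Decidable)
open import Relation.Binary.Definitions using (DecidableEquality)
open import Relation.Binary.PropositionalEquality using (_≡_; _≢_; refl; sym; trans; cong)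
open import Algebra.Core using (Op₁; Op₂)
open import Algebra.Structures using (IsCommutativeRing)
open import Function.Bundles using (_↔_; Inverse)

record IsField {A : Set} (_+_ _*_ : Op₂ A) (-_ : Op₁ A) (0# 1# : A) : Set where
  field
    isCommutativeRing : IsCommutativeRing _≡_ _+_ _*_ -_ 0# 1#
    0≢1               : 0# ≢ 1#
    inv               : ∀ x → x ≢ 0# → ∃ λ y → x * y ≡ 1#

record FiniteField (q : ℕ) : Set₁ where
  infixl 6 _+_ _-_
  infixl 7 _*_
  infixr 8 _^ᶠ_
  infix 4 _≟_
  field
    Carrier : Set
    _+_ _*_ : Op₂ Carrier
    -_      : Op₁ Carrier
    0# 1#   : Carrier
    isField : IsField _+_ _*_ -_ 0# 1#
    enum    : Carrier ↔ Fin q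

  _-_ : Op₂ Carrier
  x - y = x + (- y)

  _^ᶠ_ : Carrier → ℕ → Carrier
  x ^ᶠ zero  = 1#
  x ^ᶠ suc n = x * (x ^ᶠ n)

  elems : List Carrier
  elems = map (Inverse.from enum) (allFin q)

  elems-complete : ∀ x → x ∈ elems
  elems-complete x with ∈-map⁺ (Inverse.from enum) (∈-allFin (Inverse.to enum x))
  ... | p rewrite Inverse.strictlyInverseʳ enum x = p

  _≟_ : DecidableEquality Carrier
  x ≟ y = map′ to⇒ (cong (Inverse.to enum)) (Inverse.to enum x FinP.≟ Inverse.to enum y)
    where
    to⇒ : Inverse.to enum x ≡ Inverse.to enum y → x ≡ y
    to⇒ e = trans (sym (Inverse.strictlyInverseʳ enum x))
              (trans (cong (Inverse.from enum) e) (Inverse.strictlyInverseʳ enum y))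

  count : {P : Pred Carrier 0ℓ} → Decidable P → ℕ
  count P? = length (filter P? elems)

  count₂ : {P : Pred (Carrier × Carrier) 0ℓ} → Decidable P → ℕ
  count₂ P? = length (filter P? (cartesianProduct elems elems))

  Image : (Carrier → Carrier) → Pred Carrier 0ℓ
  Image F y = ∃ λ x → F x ≡ y

  image? : (F : Carrier → Carrier) → Decidable (Image F)
  image? F y = map′ Any.satisfied (λ { (x , e) → lose (elems-complete x) e })
                    (any? (λ x → F x ≟ y) elems)

  IsAPN : (Carrier → Carrier) → Set
  IsAPN F = ∀ a b → a ≢ 0# → count (λ x → F (x + a) - F x ≟ b) ℕ.≤ 2

  IsTwoToOne : (Carrier → Carrier) → Set
  IsTwoToOne F = ∀ y → Image F y → count (λ x → F x ≟ y) ≡ 2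

  IsRelDiffSet : (m n' k' λ' : ℕ) (R : Pred Carrier 0ℓ) → Decidable R
               → (N : Pred Carrier 0ℓ) → Decidable N → Set
  IsRelDiffSet m n' k' λ' R R? N N? =
      (m ℕ.* n' ≡ q)
    × (count N? ≡ n')
    × (count R? ≡ k')
    × (∀ g → ¬ N g → count₂ (diff? g) ≡ λ')
    × (∀ g → N g → g ≢ 0# → count₂ (diff? g) ≡ 0)
    where
    diff? : ∀ g → Decidable (λ (p : Carrier × Carrier) →
              R (proj₁ p) × R (proj₂ p) × ¬ (proj₁ p ≡ proj₂ p) × (proj₁ p - proj₂ p ≡ g))
    diff? g (r , r') = R? r ×-dec (R? r' ×-dec (¬? (r ≟ r') ×-dec ((r - r') ≟ g)))

  N₀₁ : Pred Carrier 0ℓ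
  N₀₁ g = (g ≡ 0#) ⊎ (g ≡ 1#)

  N₀₁? : Decidable N₀₁
  N₀₁? g with g ≟ 0# | g ≟ 1#
  ... | yes p | _     = yes (Data.Sum.inj₁ p)
  ... | no _  | yes p = yes (Data.Sum.inj₂ p)
  ... | no p  | no p' = no λ { (Data.Sum.inj₁ e) → p e ; (Data.Sum.inj₂ e) → p' e }

f₇ : ∀ {q} (F : FiniteField q) → ℕ → FiniteField.Carrier F → FiniteField.Carrier F
f₇ F k x = (x ^ᶠ (2 ℕ.^ k ℕ.∸ 1)) + (x ^ᶠ (2 ℕ.^ k))
  where open FiniteField F

module Submission where

-- Let q = 2 ^ (2k - 1), σ x = x ^ 2^k and ρ x = x ^ (2^k - 1). Then x ρ x = σ x, so
-- f = ρ + σ = ρ (1 + x), and σ (σ x) = x², so τ t = t σ t is a left inverse of ρ.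
--
-- Two-to-one: f⁻¹(0) = {0, 1}, and for x ≠ 0 with u = 1 / x one has f x = (1 + u) / σ u.
-- Writing the other preimage as 1 / (u + d), the condition (1 + u) σ (u + d) = (1 + u + d) σ u
-- becomes ρ d = σ u / (1 + u), whose only solution is d = τ (σ u / (1 + u)).
--
-- APN: with x = a t the equation f (x + a) + f x = b reads
-- a σ a (σ t + t) = a² (b + σ a) (t² + t). If b = f a this forces σ t = t², so t ∈ {0, 1}.
-- Otherwise σ t + t = e (t² + t) with e = a (b + σ a) / σ a, and applying σ once more
-- determines t² + t, hence t up to t ↦ t + 1.
--
-- Difference set: with Q r = r σ r, Tr (Q (f x)) = 0 and Tr (Q (r + 1)) = Tr (Q r) + 1, so the
-- image, which has q / 2 elements, is S = {r | Tr (Q r) = 0}, and no two of its elements differ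
-- by 1. For g ∉ {0, 1}, Tr (Q (r + g)) = Tr (Q r) + Tr (r M) + Tr (Q g) with M ≠ 0 and Tr M = 0,
-- so the pairs (r, r + g) in S × S are cut out of S by a hyperplane that r ↦ r + 1 preserves:
-- there are q / 4 of them.

open import Level using (0ℓ)
open import Algebra.Bundles using (CommutativeRing)
open import Algebra.Solver.Ring.AlmostCommutativeRing using (fromCommutativeRing; _-Raw-AlmostCommutative⟶_)
open import Data.Bool.Base using (Bool; true; false; _xor_; _∧_)
import Data.Bool.Properties as Bool
open import Data.Bool.Properties using (xor-∧-commutativeRing)
open import Data.Empty using (⊥-elim)
open import Data.Fin.Base using (Fin; _<_)
open import Data.Fin.Properties using (_<?_; <-asym; <-cmp)
open import Data.List using (List; []; _∷_; length; filter; map; foldr; allFin; cartesianProduct)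
open import Data.List.Properties using (filter-≐; filter-none; filter-some; length-map; length-tabulate)
open import Data.List.Membership.Propositional using (_∈_; lose)
open import Data.List.Membership.Propositional.Properties
  using (∈-filter⁺; ∈-filter⁻; ∈-map⁺; ∈-map⁻; ∈-cartesianProduct⁺)
open import Data.List.Membership.Propositional.Properties.WithK using (unique∧set⇒bag)
open import Data.List.Relation.Binary.BagAndSetEquality using (∼bag⇒↭)
open import Data.List.Relation.Binary.Permutation.Propositional using (_↭_; ↭⇒↭ₛ)
open import Data.List.Relation.Binary.Permutation.Propositional.Properties using (↭-length)
open import Data.List.Relation.Binary.Permutation.Setoid.Properties using (foldr-commMonoid)
open import Data.List.Relation.Unary.All as All using (All; []; _∷_)
import Data.List.Relation.Unary.All.Properties as All
open import Data.List.Relation.Unary.All.Properties using (all-filter)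
open import Data.List.Relation.Unary.AllPairs using ([]; _∷_)
open import Data.List.Relation.Unary.Any using (here; there)
open import Data.List.Relation.Unary.Unique.Propositional using (Unique)
import Data.List.Relation.Unary.Unique.Propositional.Properties as Unique
open import Data.Maybe.Base using (just; nothing)
open import Data.Nat as ℕ using (ℕ; zero; suc; _∸_; _≤_; z≤n; s≤s)
import Data.Nat.Properties as ℕₚ
open import Data.Product using (∃; _×_; _,_; proj₁; proj₂; <_,_>)
open import Data.Sum as Sum using (_⊎_; inj₁; inj₂; [_,_]′)
open import Function.Base using (_∘_; id)
open import Function.Bundles using (_⇔_; mk⇔; Equivalence; Inverse)
open import Relation.Binary.Definitions using (WeaklyDecidable; tri<; tri≈; tri>)
import Relation.Binary.PropositionalEquality as ≡
open import Relation.Binary.PropositionalEquality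
  using (_≡_; _≢_; refl; sym; trans; cong; cong₂; subst; module ≡-Reasoning)
open import Relation.Nullary using (¬_; yes; no)
open import Relation.Unary using (Pred; Decidable; _⊆_; _≐_; _∩_)
open import Relation.Unary.Properties using (_∩?_; ∁?)

open import Defs

pigeonhole : ∀ {A : Set} {u v x y z : A} → x ≡ u ⊎ x ≡ v → y ≡ u ⊎ y ≡ v → z ≡ u ⊎ z ≡ v →
             x ≡ y ⊎ x ≡ z ⊎ y ≡ z
pigeonhole (inj₁ refl) (inj₁ refl) _           = inj₁ refl
pigeonhole (inj₂ refl) (inj₂ refl) _           = inj₁ refl
pigeonhole (inj₁ refl) (inj₂ _)    (inj₁ refl) = inj₂ (inj₁ refl)
pigeonhole (inj₂ refl) (inj₁ _)    (inj₂ refl) = inj₂ (inj₁ refl)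
pigeonhole (inj₁ _)    (inj₂ refl) (inj₂ refl) = inj₂ (inj₂ refl)
pigeonhole (inj₂ _)    (inj₁ refl) (inj₁ refl) = inj₂ (inj₂ refl)

m+m≡n+n⇒m≡n : ∀ {m n} → m ℕ.+ m ≡ n ℕ.+ n → m ≡ n
m+m≡n+n⇒m≡n {m} {n} m+m≡n+n = ℕₚ.*-cancelˡ-≡ m n 2 (begin
  m ℕ.+ (m ℕ.+ 0)     ≡⟨ cong (m ℕ.+_) (ℕₚ.+-identityʳ m) ⟩
  m ℕ.+ m             ≡⟨ m+m≡n+n ⟩
  n ℕ.+ n             ≡⟨ cong (n ℕ.+_) (ℕₚ.+-identityʳ n) ⟨
  n ℕ.+ (n ℕ.+ 0)     ∎)
  where open ≡-Reasoning

module Enumeration {A : Set} {xs : List A} (xs-unique : Unique xs) (xs-complete : ∀ x → x ∈ xs) where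

  open import Data.Nat using (_+_)
  open import Data.Nat.Properties using (+-cancelˡ-≡; +-identityʳ; +-suc; <⇒≢)

  count : {P : Pred A 0ℓ} → Decidable P → ℕ
  count P? = length (filter P? xs)

  count-≡-length : {P : Pred A 0ℓ} (P? : Decidable P) {ys : List A} →
                   Unique ys → (∀ {y} → y ∈ ys ⇔ P y) → count P? ≡ length ys
  count-≡-length P? ys-unique ys⇔P = ↭-length (∼bag⇒↭ (unique∧set⇒bag (Unique.filter⁺ P? {xs} xs-unique) ys-unique
    (mk⇔ (λ y∈ → Equivalence.from ys⇔P (proj₂ (∈-filter⁻ P? {xs = xs} y∈)))
         (λ y∈ys → ∈-filter⁺ P? (xs-complete _) (Equivalence.to ys⇔P y∈ys)))))

  count-complement : {P : Pred A 0ℓ} (P? : Decidable P) → count P? + count (∁? P?) ≡ length xs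
  count-complement P? = complement xs
    where
    complement : ∀ ys → length (filter P? ys) + length (filter (∁? P?) ys) ≡ length ys
    complement [] = refl
    complement (y ∷ ys) with P? y
    ... | yes _ = cong suc (complement ys)
    ... | no _  = trans (+-suc _ _) (cong suc (complement ys))

  count-cong : {P Q : Pred A 0ℓ} (P? : Decidable P) (Q? : Decidable Q) → P ≐ Q → count P? ≡ count Q?
  count-cong P? Q? P≐Q = cong length (filter-≐ P? Q? P≐Q xs)

  count-split : {P Q : Pred A 0ℓ} (P? : Decidable P) (Q? : Decidable Q) →
                count P? ≡ count (P? ∩? Q?) + count (P? ∩? ∁? Q?)
  count-split P? Q? = split xs
    where
    split : ∀ ys → length (filter P? ys) ≡ length (filter (P? ∩? Q?) ys) + length (filter (P? ∩? ∁? Q?) ys)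
    split [] = refl
    split (y ∷ ys) with P? y | Q? y
    ... | yes _ | yes _ = cong suc (split ys)
    ... | yes _ | no _  = trans (cong suc (split ys)) (sym (+-suc _ _))
    ... | no _  | _     = split ys

  count-≡0 : {P : Pred A 0ℓ} (P? : Decidable P) → (∀ x → ¬ P x) → count P? ≡ 0
  count-≡0 P? ∄P = cong length (filter-none P? {xs} (All.tabulate (λ {x} _ → ∄P x)))

  count-≡0⇒∄ : {P : Pred A 0ℓ} (P? : Decidable P) → count P? ≡ 0 → ∀ x → ¬ P x
  count-≡0⇒∄ P? count≡0 x Px = <⇒≢ (filter-some P? (lose (xs-complete x) Px)) (sym count≡0)

  ⊆∧count≡⇒⊇ : {P Q : Pred A 0ℓ} (P? : Decidable P) (Q? : Decidable Q) →
               P ⊆ Q → count P? ≡ count Q? → Q ⊆ P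
  ⊆∧count≡⇒⊇ P? Q? P⊆Q count≡ {x} Qx with P? x
  ... | yes Px = Px
  ... | no ¬Px = ⊥-elim (count-≡0⇒∄ (Q? ∩? ∁? P?) none x (Qx , ¬Px))
    where
    none : count (Q? ∩? ∁? P?) ≡ 0
    none = +-cancelˡ-≡ (count P?) _ 0 (begin
      count P? + count (Q? ∩? ∁? P?)
        ≡⟨ cong (_+ count (Q? ∩? ∁? P?)) (count-cong P? (Q? ∩? P?) (< P⊆Q , id > , proj₂)) ⟩
      count (Q? ∩? P?) + count (Q? ∩? ∁? P?)    ≡⟨ count-split Q? P? ⟨
      count Q?                                  ≡⟨ count≡ ⟨
      count P?                                  ≡⟨ +-identityʳ (count P?) ⟨
      count P? + 0                              ∎)
      where open ≡-Reasoning

  count-∘-involution : {P : Pred A 0ℓ} (P? : Decidable P) (π : A → A) → (∀ x → π (π x) ≡ x) →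
                       count (P? ∘ π) ≡ count P?
  count-∘-involution {P} P? π π∘π =
    trans (count-≡-length (P? ∘ π) (Unique.map⁺ π-injective (Unique.filter⁺ P? {xs} xs-unique)) members)
          (length-map π (filter P? xs))
    where
    π-injective : ∀ {x y} → π x ≡ π y → x ≡ y
    π-injective {x} {y} πx≡πy = trans (sym (π∘π x)) (trans (cong π πx≡πy) (π∘π y))
    members : ∀ {y} → y ∈ map π (filter P? xs) ⇔ P (π y)
    members {y} = mk⇔ to from
      where
      to : y ∈ map π (filter P? xs) → P (π y)
      to y∈ with ∈-map⁻ π y∈
      ... | x , x∈ , refl = subst P (sym (π∘π x)) (proj₂ (∈-filter⁻ P? {xs = xs} x∈))
      from : P (π y) → y ∈ map π (filter P? xs)
      from Pπy = subst (_∈ _) (π∘π y) (∈-map⁺ π (∈-filter⁺ P? (xs-complete (π y)) Pπy))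

  count-half-of : {Z P : Pred A 0ℓ} (Z? : Decidable Z) (P? : Decidable P) (π : A → A) → (∀ x → π (π x) ≡ x) →
                  (∀ {x} → Z x → Z (π x)) → (∀ {x} → ¬ P x → P (π x)) → (∀ {x} → P x → ¬ P (π x)) →
                  count (Z? ∩? P?) + count (Z? ∩? P?) ≡ count Z?
  count-half-of {Z} {P} Z? P? π π∘π Z-π P-π ¬P-π = begin
    count (Z? ∩? P?) + count (Z? ∩? P?)              ≡⟨ cong (_ +_) (count-∘-involution (Z? ∩? P?) π π∘π) ⟨
    count (Z? ∩? P?) + count ((Z? ∩? P?) ∘ π)        ≡⟨ cong (_ +_) (count-cong _ _ (flip , unflip)) ⟨
    count (Z? ∩? P?) + count (Z? ∩? ∁? P?)           ≡⟨ count-split Z? P? ⟨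
    count Z?                                         ∎
    where
    open ≡-Reasoning
    flip : ∀ {x} → Z x × ¬ P x → Z (π x) × P (π x)
    flip (Zx , ¬Px) = Z-π Zx , P-π ¬Px
    unflip : ∀ {x} → Z (π x) × P (π x) → Z x × ¬ P x
    unflip {x} (Zπx , Pπx) = subst Z (π∘π x) (Z-π Zπx) , λ Px → ¬P-π Px Pπx

  count-half : {P : Pred A 0ℓ} (P? : Decidable P) (π : A → A) → (∀ x → π (π x) ≡ x) →
               (∀ {x} → ¬ P x → P (π x)) → (∀ {x} → P x → ¬ P (π x)) →
               count P? + count P? ≡ length xs
  count-half {P} P? π π∘π P-π ¬P-π = begin
    count P? + count P?            ≡⟨ cong (count P? +_) (count-∘-involution P? π π∘π) ⟨
    count P? + count (P? ∘ π)
      ≡⟨ cong (count P? +_) (count-cong (∁? P?) (P? ∘ π) (P-π , λ Pπx Px → ¬P-π Px Pπx)) ⟨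
    count P? + count (∁? P?)       ≡⟨ count-complement P? ⟩
    length xs                      ∎
    where open ≡-Reasoning

  count-≤-2 : {P : Pred A 0ℓ} (P? : Decidable P) →
              (∀ {x y z} → P x → P y → P z → x ≡ y ⊎ x ≡ z ⊎ y ≡ z) → count P? ≤ 2
  count-≤-2 {P} P? among-three = ≤2 (filter P? xs) (Unique.filter⁺ P? {xs} xs-unique) (all-filter P? xs)
    where
    ≤2 : ∀ ys → Unique ys → All P ys → length ys ≤ 2
    ≤2 []            _ _ = z≤n
    ≤2 (_ ∷ [])      _ _ = s≤s z≤n
    ≤2 (_ ∷ _ ∷ [])  _ _ = s≤s (s≤s z≤n)
    ≤2 (_ ∷ _ ∷ _ ∷ _) ((x≢y ∷ x≢z ∷ _) ∷ (y≢z ∷ _) ∷ _) (Px ∷ Py ∷ Pz ∷ _)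
      with among-three Px Py Pz
    ... | inj₁ x≡y        = ⊥-elim (x≢y x≡y)
    ... | inj₂ (inj₁ x≡z) = ⊥-elim (x≢z x≡z)
    ... | inj₂ (inj₂ y≡z) = ⊥-elim (y≢z y≡z)

Characteristic2 : ∀ {c ℓ} → CommutativeRing c ℓ → Set ℓ
Characteristic2 R = 1# + 1# ≈ 0#
  where open CommutativeRing R

-- With coefficients in F₂ = (Bool, xor, ∧) the ring solver normalises modulo 2, so it proves
-- the identities that hold only in characteristic 2.
module F₂-Solver {c ℓ} (R : CommutativeRing c ℓ) (1+1≈0 : Characteristic2 R) where

  open CommutativeRing R renaming (sym to ≈-sym; refl to ≈-refl)

  open import Algebra.Properties.Ring ring using (-0#≈0#)
  open import Relation.Binary.Reasoning.Setoid setoid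

  ⟦_⟧₂ : Bool → Carrier
  ⟦ true  ⟧₂ = 1#
  ⟦ false ⟧₂ = 0#

  -1≈1 : - 1# ≈ 1#
  -1≈1 = begin
    - 1#               ≈⟨ +-identityʳ (- 1#) ⟨
    - 1# + 0#          ≈⟨ +-congˡ 1+1≈0 ⟨
    - 1# + (1# + 1#)   ≈⟨ +-assoc (- 1#) 1# 1# ⟨
    - 1# + 1# + 1#     ≈⟨ +-congʳ (-‿inverseˡ 1#) ⟩
    0# + 1#            ≈⟨ +-identityˡ 1# ⟩
    1#                 ∎

  F₂⟶R : CommutativeRing.rawRing xor-∧-commutativeRing -Raw-AlmostCommutative⟶ fromCommutativeRing R
  F₂⟶R = record
    { ⟦_⟧    = ⟦_⟧₂
    ; +-homo = +-homo
    ; *-homo = *-homo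
    ; -‿homo = λ { true → ≈-sym -1≈1 ; false → ≈-sym -0#≈0# }
    ; 0-homo = ≈-refl
    ; 1-homo = ≈-refl
    }
    where
    +-homo : ∀ a b → ⟦ a xor b ⟧₂ ≈ ⟦ a ⟧₂ + ⟦ b ⟧₂
    +-homo true  true  = ≈-sym 1+1≈0
    +-homo true  false = ≈-sym (+-identityʳ 1#)
    +-homo false b     = ≈-sym (+-identityˡ ⟦ b ⟧₂)
    *-homo : ∀ a b → ⟦ a ∧ b ⟧₂ ≈ ⟦ a ⟧₂ * ⟦ b ⟧₂
    *-homo true  b = ≈-sym (*-identityˡ ⟦ b ⟧₂)
    *-homo false b = ≈-sym (zeroˡ ⟦ b ⟧₂)

  ⟦⟧₂-equal? : WeaklyDecidable (λ a b → ⟦ a ⟧₂ ≈ ⟦ b ⟧₂)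
  ⟦⟧₂-equal? a b with a Bool.≟ b
  ... | yes ≡.refl = just ≈-refl
  ... | no _       = nothing

  open import Algebra.Solver.Ring (CommutativeRing.rawRing xor-∧-commutativeRing) (fromCommutativeRing R) F₂⟶R ⟦⟧₂-equal?
    public using (solve; _:=_; _:+_; _:*_; :-_; con)

module FiniteFieldProperties {q : ℕ} (F : FiniteField q) where

  open FiniteField F
  open IsField isField using (isCommutativeRing; inv)
  open IsField isField public using (0≢1)

  commutativeRing : CommutativeRing 0ℓ 0ℓ
  commutativeRing = record { isCommutativeRing = isCommutativeRing }

  open CommutativeRing commutativeRing public
    using ( +-assoc; +-identityˡ; +-identityʳ; -‿inverseʳ
          ; *-assoc; *-comm; *-identityˡ; *-identityʳ; zeroˡ; zeroʳ; distribˡ; distribʳ )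
  open CommutativeRing commutativeRing using (*-isCommutativeMonoid; *-commutativeSemigroup; ring)
  open import Algebra.Properties.Ring ring using (x[y-z]≈xy-xz; x∙y⁻¹≈ε⇒x≈y; x≈y⇒x∙y⁻¹≈ε)
  open import Algebra.Properties.CommutativeSemigroup *-commutativeSemigroup public using (interchange)
  open ≡-Reasoning

  elems-unique : Unique elems
  elems-unique = Unique.map⁺ from-injective (Unique.allFin⁺ q)
    where
    from-injective : ∀ {i j} → Inverse.from enum i ≡ Inverse.from enum j → i ≡ j
    from-injective {i} {j} eq = begin
      i                                    ≡⟨ Inverse.strictlyInverseˡ enum i ⟨
      Inverse.to enum (Inverse.from enum i) ≡⟨ cong (Inverse.to enum) eq ⟩
      Inverse.to enum (Inverse.from enum j) ≡⟨ Inverse.strictlyInverseˡ enum j ⟩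
      j                                    ∎

  length-elems : length elems ≡ q
  length-elems = trans (length-map (Inverse.from enum) (allFin q)) (length-tabulate id)

  open Enumeration elems-unique elems-complete public hiding (count)

  pairs-complete : ∀ p → p ∈ cartesianProduct elems elems
  pairs-complete (x , y) = ∈-cartesianProduct⁺ (elems-complete x) (elems-complete y)

  module Pairs = Enumeration (Unique.cartesianProduct⁺ elems-unique elems-unique) pairs-complete

  1≢0 : 1# ≢ 0#
  1≢0 = 0≢1 ∘ sym

  count-N₀₁ : count N₀₁? ≡ 2
  count-N₀₁ = count-≡-length N₀₁? ((0≢1 ∷ []) ∷ [] ∷ []) (mk⇔ to from)
    where
    to : ∀ {x} → x ∈ 0# ∷ 1# ∷ [] → N₀₁ x
    to (here x≡0)         = inj₁ x≡0
    to (there (here x≡1)) = inj₂ x≡1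
    from : ∀ {x} → N₀₁ x → x ∈ 0# ∷ 1# ∷ []
    from (inj₁ x≡0) = here x≡0
    from (inj₂ x≡1) = there (here x≡1)

  x*y≡0⇒x≡0∨y≡0 : ∀ {x y} → x * y ≡ 0# → x ≡ 0# ⊎ y ≡ 0#
  x*y≡0⇒x≡0∨y≡0 {x} {y} xy≡0 with x ≟ 0#
  ... | yes x≡0 = inj₁ x≡0
  ... | no x≢0  = inj₂ (y≡0 (inv x x≢0))
    where
    y≡0 : ∃ (λ x′ → x * x′ ≡ 1#) → y ≡ 0#
    y≡0 (x′ , xx′≡1) = begin
      y              ≡⟨ *-identityˡ y ⟨
      1# * y         ≡⟨ cong (_* y) xx′≡1 ⟨
      x * x′ * y     ≡⟨ cong (_* y) (*-comm x x′) ⟩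
      x′ * x * y     ≡⟨ *-assoc x′ x y ⟩
      x′ * (x * y)   ≡⟨ cong (x′ *_) xy≡0 ⟩
      x′ * 0#        ≡⟨ zeroʳ x′ ⟩
      0#             ∎

  *-nonzero : ∀ {x y} → x ≢ 0# → y ≢ 0# → x * y ≢ 0#
  *-nonzero x≢0 y≢0 xy≡0 = [ x≢0 , y≢0 ]′ (x*y≡0⇒x≡0∨y≡0 xy≡0)

  *-cancelˡ : ∀ {x y z} → x ≢ 0# → x * y ≡ x * z → y ≡ z
  *-cancelˡ {x} {y} {z} x≢0 xy≡xz with x*y≡0⇒x≡0∨y≡0 (trans (x[y-z]≈xy-xz x y z) (x≈y⇒x∙y⁻¹≈ε xy≡xz))
  ... | inj₁ x≡0   = ⊥-elim (x≢0 x≡0)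
  ... | inj₂ y-z≡0 = x∙y⁻¹≈ε⇒x≈y y z y-z≡0

  *-cancelʳ : ∀ {x y z} → x ≢ 0# → y * x ≡ z * x → y ≡ z
  *-cancelʳ {x} {y} {z} x≢0 yx≡zx = *-cancelˡ x≢0 (trans (*-comm x y) (trans yx≡zx (*-comm z x)))

  ^-distribˡ-+-* : ∀ x m n → x ^ᶠ (m ℕ.+ n) ≡ x ^ᶠ m * x ^ᶠ n
  ^-distribˡ-+-* x zero    n = sym (*-identityˡ _)
  ^-distribˡ-+-* x (suc m) n = trans (cong (x *_) (^-distribˡ-+-* x m n)) (sym (*-assoc x _ _))

  1^n≡1 : ∀ n → 1# ^ᶠ n ≡ 1#
  1^n≡1 zero    = refl
  1^n≡1 (suc n) = trans (*-identityˡ _) (1^n≡1 n)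

  ∏ : List Carrier → Carrier
  ∏ = foldr _*_ 1#

  ∏-↭ : ∀ {xs ys} → xs ↭ ys → ∏ xs ≡ ∏ ys
  ∏-↭ xs↭ys = foldr-commMonoid (≡.setoid Carrier) *-isCommutativeMonoid (↭⇒↭ₛ xs↭ys)

  ∏-map-* : ∀ a xs → ∏ (map (a *_) xs) ≡ a ^ᶠ length xs * ∏ xs
  ∏-map-* a []       = sym (*-identityˡ 1#)
  ∏-map-* a (x ∷ xs) = trans (cong (a * x *_) (∏-map-* a xs)) (interchange a x (a ^ᶠ length xs) (∏ xs))

  ∏-nonzero : ∀ {xs} → All (_≢ 0#) xs → ∏ xs ≢ 0#
  ∏-nonzero []              = 1≢0
  ∏-nonzero (x≢0 ∷ xs≢0) = *-nonzero x≢0 (∏-nonzero xs≢0)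

  nonzeros : List Carrier
  nonzeros = filter (∁? (_≟ 0#)) elems

  q≡1+|nonzeros| : q ≡ suc (length nonzeros)
  q≡1+|nonzeros| = begin
    q                                 ≡⟨ length-elems ⟨
    length elems                      ≡⟨ count-complement (_≟ 0#) ⟨
    count (_≟ 0#) ℕ.+ length nonzeros ≡⟨ cong (ℕ._+ length nonzeros) count-zero ⟩
    suc (length nonzeros)             ∎
    where
    count-zero : count (_≟ 0#) ≡ 1
    count-zero = count-≡-length (_≟ 0#) ([] ∷ []) (mk⇔ (λ { (here x≡0) → x≡0 ; (there ()) }) here)

  *-permutes-nonzeros : ∀ {a} → a ≢ 0# → map (a *_) nonzeros ↭ nonzeros
  *-permutes-nonzeros {a} a≢0 =
    ∼bag⇒↭ (unique∧set⇒bag (Unique.map⁺ (*-cancelˡ a≢0) nonzeros-unique) nonzeros-unique (mk⇔ to (from (inv a a≢0))))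
    where
    nonzeros-unique : Unique nonzeros
    nonzeros-unique = Unique.filter⁺ (∁? (_≟ 0#)) elems-unique
    to : ∀ {y} → y ∈ map (a *_) nonzeros → y ∈ nonzeros
    to y∈ with ∈-map⁻ (a *_) y∈
    ... | x , x∈ , refl = ∈-filter⁺ (∁? (_≟ 0#)) (elems-complete (a * x))
                            (*-nonzero a≢0 (proj₂ (∈-filter⁻ (∁? (_≟ 0#)) {xs = elems} x∈)))
    from : ∃ (λ a′ → a * a′ ≡ 1#) → ∀ {y} → y ∈ nonzeros → y ∈ map (a *_) nonzeros
    from (a′ , aa′≡1) {y} y∈ = subst (_∈ map (a *_) nonzeros) a[a′y]≡y
      (∈-map⁺ (a *_) (∈-filter⁺ (∁? (_≟ 0#)) (elems-complete (a′ * y)) a′y≢0))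
      where
      a[a′y]≡y : a * (a′ * y) ≡ y
      a[a′y]≡y = trans (sym (*-assoc a a′ y)) (trans (cong (_* y) aa′≡1) (*-identityˡ y))
      a′y≢0 : a′ * y ≢ 0#
      a′y≢0 a′y≡0 = proj₂ (∈-filter⁻ (∁? (_≟ 0#)) {xs = elems} y∈)
                          (trans (sym a[a′y]≡y) (trans (cong (a *_) a′y≡0) (zeroʳ a)))

  x^|nonzeros|≡1 : ∀ {x} → x ≢ 0# → x ^ᶠ length nonzeros ≡ 1#
  x^|nonzeros|≡1 {x} x≢0 = *-cancelʳ (∏-nonzero (all-filter (∁? (_≟ 0#)) elems)) (begin
    x ^ᶠ length nonzeros * ∏ nonzeros   ≡⟨ ∏-map-* x nonzeros ⟨
    ∏ (map (x *_) nonzeros)             ≡⟨ ∏-↭ (*-permutes-nonzeros x≢0) ⟩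
    ∏ nonzeros                          ≡⟨ *-identityˡ _ ⟨
    1# * ∏ nonzeros                     ∎)

  x^q≡x : ∀ x → x ^ᶠ q ≡ x
  x^q≡x x with x ≟ 0#
  ... | yes refl = trans (cong (0# ^ᶠ_) q≡1+|nonzeros|) (zeroˡ _)
  ... | no x≢0   = begin
    x ^ᶠ q                      ≡⟨ cong (x ^ᶠ_) q≡1+|nonzeros| ⟩
    x * x ^ᶠ length nonzeros    ≡⟨ cong (x *_) (x^|nonzeros|≡1 x≢0) ⟩
    x * 1#                      ≡⟨ *-identityʳ x ⟩
    x                           ∎

  -- The Fermat inverse; 0 ⁻¹ = 0.
  _⁻¹ : Carrier → Carrier
  x ⁻¹ = x ^ᶠ (q ∸ 2)

  *-inverseʳ : ∀ {x} → x ≢ 0# → x * x ⁻¹ ≡ 1#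
  *-inverseʳ {x} x≢0 = trans (cong (x ^ᶠ_) 1+[q∸2]≡|nonzeros|) (x^|nonzeros|≡1 x≢0)
    where
    1+[q∸2]≡|nonzeros| : suc (q ∸ 2) ≡ length nonzeros
    1+[q∸2]≡|nonzeros| = trans (cong (λ n → suc (n ∸ 2)) q≡1+|nonzeros|)
                               (ℕₚ.m+[n∸m]≡n (filter-some (∁? (_≟ 0#)) (lose (elems-complete 1#) 1≢0)))

  *-inverseˡ : ∀ {x} → x ≢ 0# → x ⁻¹ * x ≡ 1#
  *-inverseˡ {x} x≢0 = trans (*-comm (x ⁻¹) x) (*-inverseʳ x≢0)

  ⁻¹-nonzero : ∀ {x} → x ≢ 0# → x ⁻¹ ≢ 0#
  ⁻¹-nonzero {x} x≢0 x⁻¹≡0 = 1≢0 (trans (sym (*-inverseʳ x≢0)) (trans (cong (x *_) x⁻¹≡0) (zeroʳ x)))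

  ⁻¹-involutive : ∀ {x} → x ≢ 0# → x ⁻¹ ⁻¹ ≡ x
  ⁻¹-involutive x≢0 = *-cancelˡ (⁻¹-nonzero x≢0) (trans (*-inverseʳ (⁻¹-nonzero x≢0)) (sym (*-inverseˡ x≢0)))

  ⁻¹-injective : ∀ {x y} → x ≢ 0# → y ≢ 0# → x ⁻¹ ≡ y ⁻¹ → x ≡ y
  ⁻¹-injective x≢0 y≢0 x⁻¹≡y⁻¹ =
    trans (sym (⁻¹-involutive x≢0)) (trans (cong _⁻¹ x⁻¹≡y⁻¹) (⁻¹-involutive y≢0))

  1⁻¹≡1 : 1# ⁻¹ ≡ 1#
  1⁻¹≡1 = 1^n≡1 (q ∸ 2)

  module TwoToOneByPartner (f partner : Carrier → Carrier)
    (partner-≢ : ∀ x → partner x ≢ x)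
    (f∘partner : ∀ x → f (partner x) ≡ f x)
    (fibre : ∀ {x y} → f y ≡ f x → y ≡ x ⊎ y ≡ partner x) where

    partner-involutive : ∀ x → partner (partner x) ≡ x
    partner-involutive x with fibre (trans (f∘partner (partner x)) (f∘partner x))
    ... | inj₁ pp≡x  = pp≡x
    ... | inj₂ pp≡p = ⊥-elim (partner-≢ (partner x) pp≡p)

    isTwoToOne : IsTwoToOne f
    isTwoToOne _ (x , refl) =
      count-≡-length (λ y → f y ≟ f x) (((partner-≢ x ∘ sym) ∷ []) ∷ [] ∷ []) (mk⇔ to from)
      where
      to : ∀ {y} → y ∈ x ∷ partner x ∷ [] → f y ≡ f x
      to (here refl)         = refl
      to (there (here refl)) = f∘partner x
      from : ∀ {y} → f y ≡ f x → y ∈ x ∷ partner x ∷ []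
      from fy≡fx = [ here , there ∘ here ]′ (fibre fy≡fx)

    index : Carrier → Fin q
    index = Inverse.to enum

    index-injective : ∀ {x y} → index x ≡ index y → x ≡ y
    index-injective {x} {y} eq = begin
      x                         ≡⟨ Inverse.strictlyInverseʳ enum x ⟨
      Inverse.from enum (index x) ≡⟨ cong (Inverse.from enum) eq ⟩
      Inverse.from enum (index y) ≡⟨ Inverse.strictlyInverseʳ enum y ⟩
      y                         ∎

    -- Choosing in every fibre {x, partner x} the element of smaller index
    -- identifies the image of f with half of the field.
    Leader : Pred Carrier 0ℓ
    Leader x = index x < index (partner x)

    leader? : Decidable Leader
    leader? x = index x <? index (partner x)

    leader-partner : ∀ {x} → Leader x → ¬ Leader (partner x)
    leader-partner {x} x<px px<ppx = <-asym x<px (subst (λ z → index (partner x) < index z) (partner-involutive x) px<ppx)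

    non-leader-partner : ∀ {x} → ¬ Leader x → Leader (partner x)
    non-leader-partner {x} ¬x<px with <-cmp (index x) (index (partner x))
    ... | tri< x<px _ _      = ⊥-elim (¬x<px x<px)
    ... | tri≈ _ x≡px _      = ⊥-elim (partner-≢ x (sym (index-injective x≡px)))
    ... | tri> _ _ px<x      = subst (λ z → index (partner x) < index z) (sym (partner-involutive x)) px<x

    leaders-collide : ∀ {x y} → Leader x → Leader y → f x ≡ f y → x ≡ y
    leaders-collide {x} {y} Lx Ly fx≡fy with fibre (sym fx≡fy)
    ... | inj₁ y≡x  = sym y≡x
    ... | inj₂ refl = ⊥-elim (leader-partner Lx Ly)

    map-f-unique : ∀ {ys} → Unique ys → All Leader ys → Unique (map f ys)
    map-f-unique []             []         = []
    map-f-unique (x∉ys ∷ ys-unique) (Lx ∷ Lys) =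
      All.map⁺ (All.zipWith (λ (x≢y , Ly) fx≡fy → x≢y (leaders-collide Lx Ly fx≡fy)) (x∉ys , Lys))
      ∷ map-f-unique ys-unique Lys

    count-image≡count-leaders : count (image? f) ≡ count leader?
    count-image≡count-leaders =
      trans (count-≡-length (image? f) (map-f-unique (Unique.filter⁺ leader? elems-unique) (all-filter leader? elems)) (mk⇔ to from))
            (length-map f (filter leader? elems))
      where
      to : ∀ {y} → y ∈ map f (filter leader? elems) → Image f y
      to y∈ with ∈-map⁻ f y∈
      ... | x , _ , y≡fx = x , sym y≡fx
      leader-in-fibre : ∀ x → ∃ λ x′ → Leader x′ × f x′ ≡ f x
      leader-in-fibre x with leader? x
      ... | yes Lx = x , Lx , refl
      ... | no ¬Lx = partner x , non-leader-partner ¬Lx , f∘partner x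
      from : ∀ {y} → Image f y → y ∈ map f (filter leader? elems)
      from (x , refl) with leader-in-fibre x
      ... | x′ , Lx′ , fx′≡fx =
        subst (_∈ map f (filter leader? elems)) fx′≡fx (∈-map⁺ f (∈-filter⁺ leader? (elems-complete x′) Lx′))

    count-image : count (image? f) ℕ.+ count (image? f) ≡ q
    count-image = begin
      count (image? f) ℕ.+ count (image? f) ≡⟨ cong₂ ℕ._+_ count-image≡count-leaders count-image≡count-leaders ⟩
      count leader? ℕ.+ count leader?       ≡⟨ count-half leader? partner partner-involutive non-leader-partner leader-partner ⟩
      length elems                          ≡⟨ length-elems ⟩
      q                                     ∎

module BinaryField {q : ℕ} (F : FiniteField q) (n : ℕ) (q≡2^[1+n] : q ≡ 2 ℕ.^ suc n) where

  open FiniteField F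
  open FiniteFieldProperties F
  open import Algebra.Properties.Ring (CommutativeRing.ring commutativeRing) using (-1*x≈-x; -‿involutive)
  open ≡-Reasoning

  frob : ℕ → Carrier → Carrier
  frob zero    x = x
  frob (suc j) x = frob j x * frob j x

  frob≡^ : ∀ j x → frob j x ≡ x ^ᶠ (2 ℕ.^ j)
  frob≡^ zero    x = sym (*-identityʳ x)
  frob≡^ (suc j) x = begin
    frob j x * frob j x                     ≡⟨ cong₂ _*_ (frob≡^ j x) (frob≡^ j x) ⟩
    x ^ᶠ (2 ℕ.^ j) * x ^ᶠ (2 ℕ.^ j)         ≡⟨ ^-distribˡ-+-* x (2 ℕ.^ j) (2 ℕ.^ j) ⟨
    x ^ᶠ (2 ℕ.^ j ℕ.+ 2 ℕ.^ j)              ≡⟨ cong (λ e → x ^ᶠ (2 ℕ.^ j ℕ.+ e)) (ℕₚ.+-identityʳ (2 ℕ.^ j)) ⟨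
    x ^ᶠ (2 ℕ.^ suc j)                      ∎

  frob-∘ : ∀ i j x → frob (i ℕ.+ j) x ≡ frob i (frob j x)
  frob-∘ zero    j x = refl
  frob-∘ (suc i) j x = cong₂ _*_ (frob-∘ i j x) (frob-∘ i j x)

  frob-* : ∀ j x y → frob j (x * y) ≡ frob j x * frob j y
  frob-* zero    x y = refl
  frob-* (suc j) x y = trans (cong₂ _*_ (frob-* j x y) (frob-* j x y)) (interchange (frob j x) (frob j y) (frob j x) (frob j y))

  frob-1 : ∀ j → frob j 1# ≡ 1#
  frob-1 zero    = refl
  frob-1 (suc j) = trans (cong₂ _*_ (frob-1 j) (frob-1 j)) (*-identityʳ 1#)

  frob-0 : ∀ j → frob j 0# ≡ 0#
  frob-0 zero    = refl
  frob-0 (suc j) = trans (cong₂ _*_ (frob-0 j) (frob-0 j)) (zeroʳ 0#)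

  frob-[1+n]≡id : ∀ x → frob (suc n) x ≡ x
  frob-[1+n]≡id x = trans (frob≡^ (suc n) x) (trans (cong (x ^ᶠ_) (sym q≡2^[1+n])) (x^q≡x x))

  -- - 1 is fixed by frob (1 + n) but is mapped to 1 by its first squaring.
  1+1≡0 : 1# + 1# ≡ 0#
  1+1≡0 = trans (cong (1# +_) (sym -1≡1)) (-‿inverseʳ 1#)
    where
    -1≡1 : - 1# ≡ 1#
    -1≡1 = begin
      - 1#                    ≡⟨ frob-[1+n]≡id (- 1#) ⟨
      frob (suc n) (- 1#)     ≡⟨ cong (λ j → frob j (- 1#)) (ℕₚ.+-comm 1 n) ⟩
      frob (n ℕ.+ 1) (- 1#)   ≡⟨ frob-∘ n 1 (- 1#) ⟩
      frob n (- 1# * - 1#)    ≡⟨ cong (frob n) (trans (-1*x≈-x (- 1#)) (-‿involutive 1#)) ⟩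
      frob n 1#               ≡⟨ frob-1 n ⟩
      1#                      ∎

  open F₂-Solver commutativeRing 1+1≡0 public

  x+x≡0 : ∀ x → x + x ≡ 0#
  x+x≡0 = solve 1 (λ x → x :+ x := con false) refl

  -x≡x : ∀ x → - x ≡ x
  -x≡x = solve 1 (λ x → :- x := x) refl

  x+y≡0⇒x≡y : ∀ {x y} → x + y ≡ 0# → x ≡ y
  x+y≡0⇒x≡y {x} {y} x+y≡0 = begin
    x              ≡⟨ solve 2 (λ x y → x := x :+ y :+ y) refl x y ⟩
    x + y + y      ≡⟨ cong (_+ y) x+y≡0 ⟩
    0# + y         ≡⟨ +-identityˡ y ⟩
    y              ∎

  x≡y⇒x+y≡0 : ∀ {x y} → x ≡ y → x + y ≡ 0#
  x≡y⇒x+y≡0 {x} refl = x+x≡0 x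

  [x+y]²≡x²+y² : ∀ x y → (x + y) * (x + y) ≡ x * x + y * y
  [x+y]²≡x²+y² = solve 2 (λ x y → (x :+ y) :* (x :+ y) := x :* x :+ y :* y) refl

  frob-+ : ∀ j x y → frob j (x + y) ≡ frob j x + frob j y
  frob-+ zero    x y = refl
  frob-+ (suc j) x y = trans (cong (λ z → z * z) (frob-+ j x y)) ([x+y]²≡x²+y² (frob j x) (frob j y))

  square-injective : ∀ {x y} → x * x ≡ y * y → x ≡ y
  square-injective {x} {y} x²≡y² with x*y≡0⇒x≡0∨y≡0 (trans ([x+y]²≡x²+y² x y) (x≡y⇒x+y≡0 x²≡y²))
  ... | inj₁ x+y≡0 = x+y≡0⇒x≡y x+y≡0
  ... | inj₂ x+y≡0 = x+y≡0⇒x≡y x+y≡0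

  frob-injective : ∀ j {x y} → frob j x ≡ frob j y → x ≡ y
  frob-injective zero    eq = eq
  frob-injective (suc j) eq = frob-injective j (square-injective eq)

  x²≡x⇒x≡0∨x≡1 : ∀ {x} → x * x ≡ x → x ≡ 0# ⊎ x ≡ 1#
  x²≡x⇒x≡0∨x≡1 {x} x²≡x
    with x*y≡0⇒x≡0∨y≡0 (trans (solve 1 (λ x → x :* (x :+ con true) := x :* x :+ x) refl x) (x≡y⇒x+y≡0 x²≡x))
  ... | inj₁ x≡0   = inj₁ x≡0
  ... | inj₂ x+1≡0 = inj₂ (x+y≡0⇒x≡y x+1≡0)

  x²+x≡y²+y⇒y≡x∨y≡x+1 : ∀ {x y} → x * x + x ≡ y * y + y → y ≡ x ⊎ y ≡ x + 1#
  x²+x≡y²+y⇒y≡x∨y≡x+1 {x} {y} eq with x*y≡0⇒x≡0∨y≡0 (trans factor (x≡y⇒x+y≡0 eq))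
    where
    factor : (x + y) * (x + y + 1#) ≡ x * x + x + (y * y + y)
    factor = solve 2 (λ x y → (x :+ y) :* (x :+ y :+ con true) := (x :* x :+ x) :+ (y :* y :+ y)) refl x y
  ... | inj₁ x+y≡0   = inj₁ (sym (x+y≡0⇒x≡y x+y≡0))
  ... | inj₂ x+y+1≡0 = inj₂ (begin
    y                             ≡⟨ solve 2 (λ x y → y := x :+ con true :+ (x :+ y :+ con true)) refl x y ⟩
    x + 1# + (x + y + 1#)         ≡⟨ cong (x + 1# +_) x+y+1≡0 ⟩
    x + 1# + 0#                   ≡⟨ +-identityʳ (x + 1#) ⟩
    x + 1#                        ∎)

  -- tr j x = x + x² + x⁴ + … + x ^ 2^(j - 1), so Tr is the absolute trace.
  tr : ℕ → Carrier → Carrier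
  tr zero    x = 0#
  tr (suc j) x = x + tr j (x * x)

  Tr : Carrier → Carrier
  Tr = tr (suc n)

  tr-+ : ∀ j x y → tr j (x + y) ≡ tr j x + tr j y
  tr-+ zero    x y = sym (+-identityʳ 0#)
  tr-+ (suc j) x y = begin
    x + y + tr j ((x + y) * (x + y))            ≡⟨ cong (λ z → x + y + tr j z) ([x+y]²≡x²+y² x y) ⟩
    x + y + tr j (x * x + y * y)                ≡⟨ cong (x + y +_) (tr-+ j (x * x) (y * y)) ⟩
    x + y + (tr j (x * x) + tr j (y * y))       ≡⟨ solve 4 (λ x y a b → x :+ y :+ (a :+ b) := x :+ a :+ (y :+ b)) refl x y _ _ ⟩
    x + tr j (x * x) + (y + tr j (y * y))       ∎

  Tr-+ : ∀ x y → Tr (x + y) ≡ Tr x + Tr y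
  Tr-+ = tr-+ (suc n)

  Tr-0 : Tr 0# ≡ 0#
  Tr-0 = trans (cong Tr (sym (x+x≡0 0#))) (trans (Tr-+ 0# 0#) (x+x≡0 (Tr 0#)))

  tr-suc : ∀ j x → tr (suc j) x ≡ tr j x + frob j x
  tr-suc zero    x = trans (+-identityʳ x) (sym (+-identityˡ x))
  tr-suc (suc j) x = begin
    x + tr (suc j) (x * x)                  ≡⟨ cong (x +_) (tr-suc j (x * x)) ⟩
    x + (tr j (x * x) + frob j (x * x))     ≡⟨ +-assoc x _ _ ⟨
    x + tr j (x * x) + frob j (x * x)       ≡⟨ cong (tr (suc j) x +_) (frob-* j x x) ⟩
    tr (suc j) x + frob (suc j) x           ∎

  -- Tr is invariant under squaring because frob (1 + n) is the identity.
  Tr-square : ∀ x → Tr (x * x) ≡ Tr x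
  Tr-square x = begin
    Tr (x * x)                ≡⟨ solve 2 (λ x t → t := x :+ (x :+ t)) refl x (Tr (x * x)) ⟩
    x + tr (suc (suc n)) x    ≡⟨ cong (x +_) (trans (tr-suc (suc n) x) (cong (Tr x +_) (frob-[1+n]≡id x))) ⟩
    x + (Tr x + x)            ≡⟨ solve 2 (λ x t → x :+ (t :+ x) := t) refl x (Tr x) ⟩
    Tr x                      ∎

  Tr-frob : ∀ j x → Tr (frob j x) ≡ Tr x
  Tr-frob zero    x = refl
  Tr-frob (suc j) x = trans (Tr-square (frob j x)) (Tr-frob j x)

  Tr-x+x² : ∀ x → Tr (x + x * x) ≡ 0#
  Tr-x+x² x = trans (Tr-+ x (x * x)) (trans (cong (Tr x +_) (Tr-square x)) (x+x≡0 (Tr x)))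

  Tr≡0∨Tr≡1 : ∀ x → Tr x ≡ 0# ⊎ Tr x ≡ 1#
  Tr≡0∨Tr≡1 x = x²≡x⇒x≡0∨x≡1 (trans (tr² (suc n) x) (Tr-square x))
    where
    tr² : ∀ j x → tr j x * tr j x ≡ tr j (x * x)
    tr² zero    x = zeroˡ 0#
    tr² (suc j) x = trans ([x+y]²≡x²+y² x (tr j (x * x))) (cong (x * x +_) (tr² j (x * x)))

  Tr≢Tr⇒Tr+1≡Tr : ∀ {x y} → Tr x ≢ Tr y → Tr x + 1# ≡ Tr y
  Tr≢Tr⇒Tr+1≡Tr {x} {y} Trx≢Try with Tr≡0∨Tr≡1 x | Tr≡0∨Tr≡1 y
  ... | inj₁ Trx≡0 | inj₁ Try≡0 = ⊥-elim (Trx≢Try (trans Trx≡0 (sym Try≡0)))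
  ... | inj₂ Trx≡1 | inj₂ Try≡1 = ⊥-elim (Trx≢Try (trans Trx≡1 (sym Try≡1)))
  ... | inj₁ Trx≡0 | inj₂ Try≡1 = trans (cong (_+ 1#) Trx≡0) (trans (+-identityˡ 1#) (sym Try≡1))
  ... | inj₂ Trx≡1 | inj₁ Try≡0 = trans (cong (_+ 1#) Trx≡1) (trans 1+1≡0 (sym Try≡0))

  x+1≢x : ∀ x → x + 1# ≢ x
  x+1≢x x x+1≡x = 1≢0 (begin
    1#               ≡⟨ solve 1 (λ x → con true := x :+ (x :+ con true)) refl x ⟩
    x + (x + 1#)     ≡⟨ cong (x +_) x+1≡x ⟩
    x + x            ≡⟨ x+x≡0 x ⟩
    0#               ∎)

  x+1+1≡x : ∀ x → x + 1# + 1# ≡ x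
  x+1+1≡x = solve 1 (λ x → x :+ con true :+ con true := x) refl

  tr-suc-1 : ∀ j → tr (suc j) 1# ≡ 1# + tr j 1#
  tr-suc-1 j = cong (λ z → 1# + tr j z) (*-identityʳ 1#)

  tr-1-odd : ∀ m → tr (suc (m ℕ.+ m)) 1# ≡ 1#
  tr-1-odd zero    = +-identityʳ 1#
  tr-1-odd (suc m) = begin
    tr (suc (suc (m ℕ.+ suc m))) 1#            ≡⟨ cong (λ j → tr (suc (suc j)) 1#) (ℕₚ.+-suc m m) ⟩
    tr (suc (suc (suc (m ℕ.+ m)))) 1#          ≡⟨ tr-suc-1 (suc (suc (m ℕ.+ m))) ⟩
    1# + tr (suc (suc (m ℕ.+ m))) 1#           ≡⟨ cong (1# +_) (tr-suc-1 (suc (m ℕ.+ m))) ⟩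
    1# + (1# + tr (suc (m ℕ.+ m)) 1#)          ≡⟨ solve 1 (λ t → con true :+ (con true :+ t) := t) refl _ ⟩
    tr (suc (m ℕ.+ m)) 1#                      ≡⟨ tr-1-odd m ⟩
    1#                                         ∎

module f₇-Properties (m : ℕ) {q : ℕ} (F : FiniteField q) (q≡2^[1+2m] : q ≡ 2 ℕ.^ suc (m ℕ.+ m)) where

  open FiniteField F
  open FiniteFieldProperties F
  open BinaryField F (m ℕ.+ m) q≡2^[1+2m]
  open ≡-Reasoning

  k : ℕ
  k = suc m

  σ : Carrier → Carrier
  σ = frob k

  ρ : Carrier → Carrier
  ρ x = x ^ᶠ (2 ℕ.^ k ∸ 1)

  τ : Carrier → Carrier
  τ t = t * σ t

  f : Carrier → Carrier
  f = f₇ F k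

  σ∘σ≡square : ∀ x → σ (σ x) ≡ x * x
  σ∘σ≡square x = begin
    σ (σ x)                          ≡⟨ frob-∘ k k x ⟨
    frob (k ℕ.+ k) x                 ≡⟨ cong (λ j → frob (suc j) x) (ℕₚ.+-suc m m) ⟩
    frob (1 ℕ.+ suc (m ℕ.+ m)) x     ≡⟨ cong (λ y → y * y) (frob-[1+n]≡id x) ⟩
    x * x                            ∎

  σ-injective : ∀ {x y} → σ x ≡ σ y → x ≡ y
  σ-injective = frob-injective k

  σ-nonzero : ∀ {x} → x ≢ 0# → σ x ≢ 0#
  σ-nonzero x≢0 σx≡0 = x≢0 (σ-injective (trans σx≡0 (sym (frob-0 k))))

  σx≡x²⇒x≡0∨x≡1 : ∀ {x} → σ x ≡ x * x → x ≡ 0# ⊎ x ≡ 1#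
  σx≡x²⇒x≡0∨x≡1 {x} σx≡x² = x²≡x⇒x≡0∨x≡1 (trans (cong (λ y → y * y) (sym frob-2m-fixes-x)) (frob-[1+n]≡id x))
    where
    frob-m-fixes-x : frob m x ≡ x
    frob-m-fixes-x = square-injective σx≡x²
    frob-2m-fixes-x : frob (m ℕ.+ m) x ≡ x
    frob-2m-fixes-x = trans (frob-∘ m m x) (trans (cong (frob m) frob-m-fixes-x) frob-m-fixes-x)

  2≤2^k : 2 ≤ 2 ℕ.^ k
  2≤2^k = ℕₚ.*-monoʳ-≤ 2 (ℕₚ.m^n>0 2 m)

  x*ρx≡σx : ∀ x → x * ρ x ≡ σ x
  x*ρx≡σx x = begin
    x * ρ x                   ≡⟨⟩
    x ^ᶠ suc (2 ℕ.^ k ∸ 1)    ≡⟨ cong (x ^ᶠ_) (ℕₚ.m+[n∸m]≡n (ℕₚ.≤-trans (s≤s z≤n) 2≤2^k)) ⟩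
    x ^ᶠ (2 ℕ.^ k)            ≡⟨ frob≡^ k x ⟨
    σ x                       ∎

  ρ0≡0 : ρ 0# ≡ 0#
  ρ0≡0 = 0^e≡0 (ℕₚ.∸-monoˡ-≤ 1 2≤2^k)
    where
    0^e≡0 : ∀ {e} → 1 ≤ e → 0# ^ᶠ e ≡ 0#
    0^e≡0 {suc e} _ = zeroˡ (0# ^ᶠ e)

  ρ1≡1 : ρ 1# ≡ 1#
  ρ1≡1 = 1^n≡1 (2 ℕ.^ k ∸ 1)

  τ∘ρ≡id : ∀ x → τ (ρ x) ≡ x
  τ∘ρ≡id x with x ≟ 0#
  ... | yes refl = trans (cong τ ρ0≡0) (zeroˡ (σ 0#))
  ... | no x≢0   = *-cancelˡ x≢0 (begin
    x * (ρ x * σ (ρ x))       ≡⟨ *-assoc x (ρ x) (σ (ρ x)) ⟨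
    x * ρ x * σ (ρ x)         ≡⟨ cong (_* σ (ρ x)) (x*ρx≡σx x) ⟩
    σ x * σ (ρ x)             ≡⟨ frob-* k x (ρ x) ⟨
    σ (x * ρ x)               ≡⟨ cong σ (x*ρx≡σx x) ⟩
    σ (σ x)                   ≡⟨ σ∘σ≡square x ⟩
    x * x                     ∎)

  f≡ρ*[1+x] : ∀ x → f x ≡ ρ x * (1# + x)
  f≡ρ*[1+x] x = begin
    ρ x + x ^ᶠ (2 ℕ.^ k)      ≡⟨ cong (ρ x +_) (frob≡^ k x) ⟨
    ρ x + σ x                 ≡⟨ cong (ρ x +_) (x*ρx≡σx x) ⟨
    ρ x + x * ρ x             ≡⟨ solve 2 (λ r x → r :+ x :* r := r :* (con true :+ x)) refl (ρ x) x ⟩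
    ρ x * (1# + x)            ∎

  f0≡0 : f 0# ≡ 0#
  f0≡0 = trans (f≡ρ*[1+x] 0#) (trans (cong (_* (1# + 0#)) ρ0≡0) (zeroˡ _))

  f1≡0 : f 1# ≡ 0#
  f1≡0 = trans (f≡ρ*[1+x] 1#) (trans (cong₂ _*_ ρ1≡1 1+1≡0) (zeroʳ 1#))

  f≡0⇒x≡0∨x≡1 : ∀ {x} → f x ≡ 0# → x ≡ 0# ⊎ x ≡ 1#
  f≡0⇒x≡0∨x≡1 {x} fx≡0 with x*y≡0⇒x≡0∨y≡0 (trans (sym (f≡ρ*[1+x] x)) fx≡0)
  ... | inj₁ ρx≡0   = inj₁ (σ-injective (begin
    σ x         ≡⟨ x*ρx≡σx x ⟨
    x * ρ x     ≡⟨ cong (x *_) ρx≡0 ⟩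
    x * 0#      ≡⟨ zeroʳ x ⟩
    0#          ≡⟨ frob-0 k ⟨
    σ 0#        ∎))
  ... | inj₂ 1+x≡0  = inj₂ (sym (x+y≡0⇒x≡y 1+x≡0))

  f*σ[x⁻¹]≡1+x⁻¹ : ∀ {x} → x ≢ 0# → f x * σ (x ⁻¹) ≡ 1# + x ⁻¹
  f*σ[x⁻¹]≡1+x⁻¹ {x} x≢0 = begin
    f x * σ u
      ≡⟨ cong (_* σ u) (trans (f≡ρ*[1+x] x) (cong (_* (1# + x)) ρx≡σx*u)) ⟩
    σ x * u * (1# + x) * σ u
      ≡⟨ solve 4 (λ s u x t → s :* u :* (con true :+ x) :* t := u :* (con true :+ x) :* (s :* t)) refl (σ x) u x (σ u) ⟩
    u * (1# + x) * (σ x * σ u)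
      ≡⟨ cong (u * (1# + x) *_) (trans (sym (frob-* k x u)) (trans (cong σ (*-inverseʳ x≢0)) (frob-1 k))) ⟩
    u * (1# + x) * 1#
      ≡⟨ solve 2 (λ u x → u :* (con true :+ x) :* con true := con true :+ u :+ (con true :+ x :* u)) refl u x ⟩
    1# + u + (1# + x * u)
      ≡⟨ cong (λ z → 1# + u + (1# + z)) (trans (*-comm x u) (*-inverseˡ x≢0)) ⟩
    1# + u + (1# + 1#)
      ≡⟨ trans (cong (1# + u +_) 1+1≡0) (+-identityʳ _) ⟩
    1# + u ∎
    where
    u : Carrier
    u = x ⁻¹
    ρx≡σx*u : ρ x ≡ σ x * u
    ρx≡σx*u = begin
      ρ x                 ≡⟨ *-identityʳ (ρ x) ⟨
      ρ x * 1#            ≡⟨ cong (ρ x *_) (*-inverseʳ x≢0) ⟨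
      ρ x * (x * u)       ≡⟨ *-assoc (ρ x) x u ⟨
      ρ x * x * u         ≡⟨ cong (_* u) (trans (*-comm (ρ x) x) (x*ρx≡σx x)) ⟩
      σ x * u             ∎

  -- f (1 / u) = (1 + u) / σ u, and Collide u v is f (1 / u) = f (1 / v) with denominators cleared.
  Collide : Carrier → Carrier → Set
  Collide u v = (1# + u) * σ v ≡ (1# + v) * σ u

  f≡f⇔collide : ∀ {x y} → x ≢ 0# → y ≢ 0# → (f x ≡ f y) ⇔ Collide (x ⁻¹) (y ⁻¹)
  f≡f⇔collide {x} {y} x≢0 y≢0 =
    mk⇔ (λ fx≡fy → trans (sym scaled-x) (trans (cong (_* c) fx≡fy) scaled-y))
        (λ collide → *-cancelʳ c≢0 (trans scaled-x (trans collide (sym scaled-y))))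
    where
    c : Carrier
    c = σ (x ⁻¹) * σ (y ⁻¹)
    c≢0 : c ≢ 0#
    c≢0 = *-nonzero (σ-nonzero (⁻¹-nonzero x≢0)) (σ-nonzero (⁻¹-nonzero y≢0))
    scaled-x : f x * c ≡ (1# + x ⁻¹) * σ (y ⁻¹)
    scaled-x = trans (sym (*-assoc (f x) _ _)) (cong (_* σ (y ⁻¹)) (f*σ[x⁻¹]≡1+x⁻¹ x≢0))
    scaled-y : f y * c ≡ (1# + y ⁻¹) * σ (x ⁻¹)
    scaled-y = trans (cong (f y *_) (*-comm _ _)) (trans (sym (*-assoc (f y) _ _)) (cong (_* σ (x ⁻¹)) (f*σ[x⁻¹]≡1+x⁻¹ y≢0)))

  collide-shift : ∀ u d → Collide u (u + d) ⇔ ((1# + u) * σ d ≡ d * σ u)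
  collide-shift u d = mk⇔ (λ c → x+y≡0⇒x≡y (trans (sym identity) (x≡y⇒x+y≡0 c)))
                          (λ e → x+y≡0⇒x≡y (trans identity (x≡y⇒x+y≡0 e)))
    where
    identity : (1# + u) * σ (u + d) + (1# + (u + d)) * σ u ≡ (1# + u) * σ d + d * σ u
    identity = trans (cong (λ z → (1# + u) * z + (1# + (u + d)) * σ u) (frob-+ k u d))
      (solve 4 (λ u d su sd → (con true :+ u) :* (su :+ sd) :+ (con true :+ (u :+ d)) :* su
                              := (con true :+ u) :* sd :+ d :* su) refl u d (σ u) (σ d))

  shift-partner : Carrier → Carrier
  shift-partner u = τ (σ u * (1# + u) ⁻¹)

  shift-partner-solves : ∀ {u} → 1# + u ≢ 0# → (1# + u) * σ (shift-partner u) ≡ shift-partner u * σ u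
  shift-partner-solves {u} 1+u≢0 = begin
    (1# + u) * σ (w * σ w)              ≡⟨ cong ((1# + u) *_) (trans (frob-* k w (σ w)) (cong (σ w *_) (σ∘σ≡square w))) ⟩
    (1# + u) * (σ w * (w * w))          ≡⟨ solve 3 (λ v w s → v :* (s :* (w :* w)) := w :* s :* (v :* w)) refl (1# + u) w (σ w) ⟩
    w * σ w * ((1# + u) * w)            ≡⟨ cong (τ w *_) [1+u]*w≡σu ⟩
    w * σ w * σ u                       ∎
    where
    w : Carrier
    w = σ u * (1# + u) ⁻¹
    [1+u]*w≡σu : (1# + u) * w ≡ σ u
    [1+u]*w≡σu = begin
      (1# + u) * (σ u * (1# + u) ⁻¹)    ≡⟨ solve 3 (λ v s i → v :* (s :* i) := s :* (i :* v)) refl (1# + u) (σ u) ((1# + u) ⁻¹) ⟩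
      σ u * ((1# + u) ⁻¹ * (1# + u))    ≡⟨ cong (σ u *_) (*-inverseˡ 1+u≢0) ⟩
      σ u * 1#                          ≡⟨ *-identityʳ (σ u) ⟩
      σ u                               ∎

  -- Dividing by d turns the equation into ρ d = σ u / (1 + u), and τ inverts ρ.
  shift-partner-unique : ∀ {u d} → 1# + u ≢ 0# → d ≢ 0# → (1# + u) * σ d ≡ d * σ u → d ≡ shift-partner u
  shift-partner-unique {u} {d} 1+u≢0 d≢0 eq = trans (sym (τ∘ρ≡id d)) (cong τ ρd≡w)
    where
    [1+u]*ρd≡σu : (1# + u) * ρ d ≡ σ u
    [1+u]*ρd≡σu = *-cancelˡ d≢0 (begin
      d * ((1# + u) * ρ d)      ≡⟨ solve 3 (λ d v r → d :* (v :* r) := v :* (d :* r)) refl d (1# + u) (ρ d) ⟩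
      (1# + u) * (d * ρ d)      ≡⟨ cong ((1# + u) *_) (x*ρx≡σx d) ⟩
      (1# + u) * σ d            ≡⟨ eq ⟩
      d * σ u                   ∎)
    ρd≡w : ρ d ≡ σ u * (1# + u) ⁻¹
    ρd≡w = *-cancelˡ 1+u≢0 (begin
      (1# + u) * ρ d                       ≡⟨ [1+u]*ρd≡σu ⟩
      σ u                                  ≡⟨ *-identityʳ (σ u) ⟨
      σ u * 1#                             ≡⟨ cong (σ u *_) (*-inverseʳ 1+u≢0) ⟨
      σ u * ((1# + u) * (1# + u) ⁻¹)       ≡⟨ solve 3 (λ s v i → s :* (v :* i) := v :* (s :* i)) refl (σ u) (1# + u) ((1# + u) ⁻¹) ⟩
      (1# + u) * (σ u * (1# + u) ⁻¹)       ∎)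

  module PartnerOf {x : Carrier} (x≢0 : x ≢ 0#) (x≢1 : x ≢ 1#) where

    u d : Carrier
    u = x ⁻¹
    d = shift-partner u

    partner′ : Carrier
    partner′ = (u + d) ⁻¹

    u≢0 : u ≢ 0#
    u≢0 = ⁻¹-nonzero x≢0

    1+u≢0 : 1# + u ≢ 0#
    1+u≢0 1+u≡0 = x≢1 (⁻¹-injective x≢0 (1≢0) (trans (sym (x+y≡0⇒x≡y 1+u≡0)) (sym 1⁻¹≡1)))

    d-solves : (1# + u) * σ d ≡ d * σ u
    d-solves = shift-partner-solves 1+u≢0

    d≢0 : d ≢ 0#
    d≢0 = *-nonzero w≢0 (σ-nonzero w≢0)
      where
      w≢0 : σ u * (1# + u) ⁻¹ ≢ 0#
      w≢0 = *-nonzero (σ-nonzero u≢0) (⁻¹-nonzero 1+u≢0)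

    u+d≢0 : u + d ≢ 0#
    u+d≢0 u+d≡0 = σ-nonzero u≢0 (begin
      σ u                                   ≡⟨ solve 2 (λ u s → s := (con true :+ u) :* s :+ u :* s) refl u (σ u) ⟩
      (1# + u) * σ u + u * σ u              ≡⟨ cong (λ z → (1# + u) * σ z + z * σ u) d≡u ⟨
      (1# + u) * σ d + d * σ u              ≡⟨ x≡y⇒x+y≡0 d-solves ⟩
      0#                                    ∎)
      where
      d≡u : d ≡ u
      d≡u = sym (x+y≡0⇒x≡y u+d≡0)

    partner′⁻¹ : partner′ ⁻¹ ≡ u + d
    partner′⁻¹ = ⁻¹-involutive u+d≢0

    partner′≢0 : partner′ ≢ 0#
    partner′≢0 = ⁻¹-nonzero u+d≢0

    f-partner′ : f partner′ ≡ f x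
    f-partner′ = sym (Equivalence.from (f≡f⇔collide x≢0 partner′≢0)
      (subst (Collide u) (sym partner′⁻¹) (Equivalence.from (collide-shift u d) d-solves)))

    partner′≢x : partner′ ≢ x
    partner′≢x partner′≡x = d≢0 (begin
      d                ≡⟨ solve 2 (λ u d → d := u :+ (u :+ d)) refl u d ⟩
      u + (u + d)      ≡⟨ cong (u +_) (trans (sym partner′⁻¹) (cong _⁻¹ partner′≡x)) ⟩
      u + u            ≡⟨ x+x≡0 u ⟩
      0#               ∎)

    fibre : ∀ {y} → f y ≡ f x → y ≡ x ⊎ y ≡ partner′
    fibre {y} fy≡fx with y ≟ x
    ... | yes y≡x = inj₁ y≡x
    ... | no y≢x  = inj₂ (⁻¹-injective y≢0 partner′≢0 (trans v≡u+d (sym partner′⁻¹)))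
      where
      y≢0 : y ≢ 0#
      y≢0 y≡0 = [ x≢0 , x≢1 ]′ (f≡0⇒x≡0∨x≡1 (trans (sym fy≡fx) (trans (cong f y≡0) f0≡0)))
      v d′ : Carrier
      v  = y ⁻¹
      d′ = u + v
      d′≢0 : d′ ≢ 0#
      d′≢0 d′≡0 = y≢x (⁻¹-injective y≢0 x≢0 (sym (x+y≡0⇒x≡y d′≡0)))
      collide : Collide u (u + d′)
      collide = subst (Collide u) (solve 2 (λ u v → v := u :+ (u :+ v)) refl u v)
                      (Equivalence.to (f≡f⇔collide x≢0 y≢0) (sym fy≡fx))
      v≡u+d : v ≡ u + d
      v≡u+d = begin
        v             ≡⟨ solve 2 (λ u v → v := u :+ (u :+ v)) refl u v ⟩
        u + d′        ≡⟨ cong (u +_) (shift-partner-unique 1+u≢0 d′≢0 (Equivalence.to (collide-shift u d′) collide)) ⟩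
        u + d         ∎

  partner : Carrier → Carrier
  partner x with x ≟ 0# | x ≟ 1#
  ... | yes _   | _       = 1#
  ... | no _    | yes _   = 0#
  ... | no x≢0  | no x≢1  = PartnerOf.partner′ x≢0 x≢1

  partner-≢ : ∀ x → partner x ≢ x
  partner-≢ x with x ≟ 0# | x ≟ 1#
  ... | yes x≡0 | _       = λ 1≡x → 1≢0 (trans 1≡x x≡0)
  ... | no _    | yes x≡1 = λ 0≡x → 0≢1 (trans 0≡x x≡1)
  ... | no x≢0  | no x≢1  = PartnerOf.partner′≢x x≢0 x≢1

  f∘partner : ∀ x → f (partner x) ≡ f x
  f∘partner x with x ≟ 0# | x ≟ 1#
  ... | yes refl | _        = trans f1≡0 (sym f0≡0)
  ... | no _     | yes refl = trans f0≡0 (sym f1≡0)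
  ... | no x≢0   | no x≢1   = PartnerOf.f-partner′ x≢0 x≢1

  partner-fibre : ∀ {x y} → f y ≡ f x → y ≡ x ⊎ y ≡ partner x
  partner-fibre {x} {y} fy≡fx with x ≟ 0# | x ≟ 1#
  ... | yes refl | _        = f≡0⇒x≡0∨x≡1 (trans fy≡fx f0≡0)
  ... | no _     | yes refl = Sum.swap (f≡0⇒x≡0∨x≡1 (trans fy≡fx f1≡0))
  ... | no x≢0   | no x≢1   = PartnerOf.fibre x≢0 x≢1 fy≡fx

  open TwoToOneByPartner f partner partner-≢ f∘partner partner-fibre public using (isTwoToOne; count-image)

  T : Carrier → Carrier
  T t = t * t + t

  σ∘T≡T∘σ : ∀ t → σ (T t) ≡ T (σ t)
  σ∘T≡T∘σ t = trans (frob-+ k (t * t) t) (cong (_+ σ t) (frob-* k t t))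

  -- Applying σ to σ s + s = e T(s) and using σ ∘ σ = squaring gives a second
  -- relation; together they fix T(s) once T(s) ≠ 0.
  σ-equation-determines-T : ∀ {s e} → σ s + s ≡ e * T s → T s ≢ 0# →
                            σ e * e * e * T s ≡ 1# + e + σ e * (1# + e)
  σ-equation-determines-T {s} {e} eq Ts≢0 = begin
    σ e * e * e * T s
      ≡⟨ solve 3 (λ e se x → se :* e :* e :* x := se :* (con true :+ e :+ e :* e :* x) :+ se :* (con true :+ e)) refl e (σ e) (T s) ⟩
    σ e * (1# + e + e * e * T s) + σ e * (1# + e)
      ≡⟨ cong (_+ σ e * (1# + e)) (sym 1+e≡σe*[…]) ⟩
    1# + e + σ e * (1# + e) ∎
    where
    σs≡s+eTs : σ s ≡ s + e * T s
    σs≡s+eTs = trans (solve 2 (λ σs s → σs := s :+ (σs :+ s)) refl (σ s) s) (cong (s +_) eq)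
    1+e≡σe*[…] : 1# + e ≡ σ e * (1# + e + e * e * T s)
    1+e≡σe*[…] = *-cancelˡ Ts≢0 (begin
      T s * (1# + e)
        ≡⟨ solve 2 (λ s e → (s :* s :+ s) :* (con true :+ e) := s :* s :+ (s :+ e :* (s :* s :+ s))) refl s e ⟩
      s * s + (s + e * T s)
        ≡⟨ cong₂ _+_ (sym (σ∘σ≡square s)) (sym σs≡s+eTs) ⟩
      σ (σ s) + σ s
        ≡⟨ frob-+ k (σ s) s ⟨
      σ (σ s + s)
        ≡⟨ cong σ eq ⟩
      σ (e * T s)
        ≡⟨ trans (frob-* k e (T s)) (cong (σ e *_) (σ∘T≡T∘σ s)) ⟩
      σ e * T (σ s)
        ≡⟨ cong (λ z → σ e * T z) σs≡s+eTs ⟩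
      σ e * T (s + e * T s)
        ≡⟨ solve 3 (λ s e se → se :* ((s :+ e :* (s :* s :+ s)) :* (s :+ e :* (s :* s :+ s)) :+ (s :+ e :* (s :* s :+ s)))
                               := (s :* s :+ s) :* (se :* (con true :+ e :+ e :* e :* (s :* s :+ s))))
                   refl s e (σ e) ⟩
      T s * (σ e * (1# + e + e * e * T s)) ∎)

  difference-after-scaling : ∀ a t → a * t * (a * t + a) * (f (a * t + a) + f (a * t))
                                     ≡ a * σ a * (σ t + t) + a * a * σ a * T t
  difference-after-scaling a t = begin
    x * y * (f y + f x)
      ≡⟨ cong (x * y *_) (cong₂ _+_ (f≡ρ*[1+x] y) (f≡ρ*[1+x] x)) ⟩
    x * y * (ρ y * (1# + y) + ρ x * (1# + x))
      ≡⟨ solve 4 (λ x y r s → x :* y :* (r :* (con true :+ y) :+ s :* (con true :+ x))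
                              := x :* (y :* r) :* (con true :+ y) :+ y :* (x :* s) :* (con true :+ x))
                 refl x y (ρ y) (ρ x) ⟩
    x * (y * ρ y) * (1# + y) + y * (x * ρ x) * (1# + x)
      ≡⟨ cong₂ (λ p r → x * p * (1# + y) + y * r * (1# + x)) (x*ρx≡σx y) (x*ρx≡σx x) ⟩
    x * σ y * (1# + y) + y * σ x * (1# + x)
      ≡⟨ cong₂ (λ p r → x * p * (1# + y) + y * r * (1# + x)) σy≡σa*σt+σa σx≡σa*σt ⟩
    x * (σ a * σ t + σ a) * (1# + y) + y * (σ a * σ t) * (1# + x)
      ≡⟨ solve 4 (λ a t sa st → a :* t :* (sa :* st :+ sa) :* (con true :+ (a :* t :+ a))
                                :+ (a :* t :+ a) :* (sa :* st) :* (con true :+ a :* t)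
                                := a :* sa :* (st :+ t) :+ a :* a :* sa :* (t :* t :+ t))
                 refl a t (σ a) (σ t) ⟩
    a * σ a * (σ t + t) + a * a * σ a * T t ∎
    where
    x y : Carrier
    x = a * t
    y = x + a
    σx≡σa*σt : σ x ≡ σ a * σ t
    σx≡σa*σt = frob-* k a t
    σy≡σa*σt+σa : σ y ≡ σ a * σ t + σ a
    σy≡σa*σt+σa = trans (frob-+ k x a) (cong (_+ σ a) σx≡σa*σt)

  module DerivativeSolutions {a : Carrier} (a≢0 : a ≢ 0#) (b : Carrier) where

    Solution : Pred Carrier 0ℓ
    Solution x = f (x + a) - f x ≡ b

    scale : Carrier → Carrier
    scale x = x * a ⁻¹

    a*scale≡id : ∀ x → a * scale x ≡ x
    a*scale≡id x = begin
      a * (x * a ⁻¹)     ≡⟨ solve 3 (λ a x i → a :* (x :* i) := x :* (a :* i)) refl a x (a ⁻¹) ⟩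
      x * (a * a ⁻¹)     ≡⟨ cong (x *_) (*-inverseʳ a≢0) ⟩
      x * 1#             ≡⟨ *-identityʳ x ⟩
      x                  ∎

    scale-injective : ∀ {x y} → scale x ≡ scale y → x ≡ y
    scale-injective {x} {y} eq = trans (sym (a*scale≡id x)) (trans (cong (a *_) eq) (a*scale≡id y))

    aσa≢0 : a * σ a ≢ 0#
    aσa≢0 = *-nonzero a≢0 (σ-nonzero a≢0)

    scaled-equation : ∀ {x} → Solution x → a * σ a * (σ (scale x) + scale x) ≡ a * a * (b + σ a) * T (scale x)
    scaled-equation {x} sol = begin
      a * σ a * (σ s + s)
        ≡⟨ solve 2 (λ u v → u := u :+ v :+ v) refl (a * σ a * (σ s + s)) (a * a * σ a * T s) ⟩
      a * σ a * (σ s + s) + a * a * σ a * T s + a * a * σ a * T s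
        ≡⟨ cong (_+ a * a * σ a * T s) (difference-after-scaling a s) ⟨
      a * s * (a * s + a) * (f (a * s + a) + f (a * s)) + a * a * σ a * T s
        ≡⟨ cong (λ z → a * s * (a * s + a) * z + a * a * σ a * T s) sol′ ⟩
      a * s * (a * s + a) * b + a * a * σ a * T s
        ≡⟨ solve 4 (λ a s b sa → a :* s :* (a :* s :+ a) :* b :+ a :* a :* sa :* (s :* s :+ s)
                    := a :* a :* (b :+ sa) :* (s :* s :+ s)) refl a s b (σ a) ⟩
      a * a * (b + σ a) * T s ∎
      where
      s : Carrier
      s = scale x
      sol′ : f (a * s + a) + f (a * s) ≡ b
      sol′ = subst (λ z → f (z + a) + f z ≡ b) (sym (a*scale≡id x)) (trans (cong (f (x + a) +_) (sym (-x≡x (f x)))) sol)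

    trivial-solution⇒b≡fa : ∀ {x} → Solution x → x ≡ 0# ⊎ x ≡ a → b ≡ f a
    trivial-solution⇒b≡fa sol (inj₁ refl) = begin
      b                       ≡⟨ sol ⟨
      f (0# + a) - f 0#       ≡⟨ cong₂ (λ y z → f y + z) (+-identityˡ a) (trans (-x≡x (f 0#)) f0≡0) ⟩
      f a + 0#                ≡⟨ +-identityʳ (f a) ⟩
      f a                     ∎
    trivial-solution⇒b≡fa sol (inj₂ refl) = begin
      b                       ≡⟨ sol ⟨
      f (a + a) - f a         ≡⟨ cong₂ (λ y z → f y + z) (x+x≡0 a) (-x≡x (f a)) ⟩
      f 0# + f a              ≡⟨ trans (cong (_+ f a) f0≡0) (+-identityˡ (f a)) ⟩
      f a                     ∎

    a*[fa+σa]≡σa : a * (f a + σ a) ≡ σ a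
    a*[fa+σa]≡σa = begin
      a * (f a + σ a)
        ≡⟨ cong (λ z → a * (z + σ a)) (f≡ρ*[1+x] a) ⟩
      a * (ρ a * (1# + a) + σ a)
        ≡⟨ solve 3 (λ a r s → a :* (r :* (con true :+ a) :+ s) := a :* r :* (con true :+ a) :+ a :* s) refl a (ρ a) (σ a) ⟩
      a * ρ a * (1# + a) + a * σ a
        ≡⟨ cong (λ z → z * (1# + a) + a * σ a) (x*ρx≡σx a) ⟩
      σ a * (1# + a) + a * σ a
        ≡⟨ solve 2 (λ a s → s :* (con true :+ a) :+ a :* s := s) refl a (σ a) ⟩
      σ a ∎

    solution-when-b≡fa : b ≡ f a → ∀ {x} → Solution x → x ≡ 0# ⊎ x ≡ a
    solution-when-b≡fa b≡fa {x} sol = Sum.map (λ s≡0 → scale-injective (trans s≡0 (sym (zeroˡ (a ⁻¹)))))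
                                              (λ s≡1 → scale-injective (trans s≡1 (sym (*-inverseʳ a≢0))))
                                              (σx≡x²⇒x≡0∨x≡1 σs≡s²)
      where
      s : Carrier
      s = scale x
      σs+s≡Ts : σ s + s ≡ T s
      σs+s≡Ts = *-cancelˡ aσa≢0 (begin
        a * σ a * (σ s + s)
          ≡⟨ scaled-equation sol ⟩
        a * a * (b + σ a) * T s
          ≡⟨ solve 4 (λ a b sa t → a :* a :* (b :+ sa) :* t := a :* (a :* (b :+ sa)) :* t) refl a b (σ a) (T s) ⟩
        a * (a * (b + σ a)) * T s
          ≡⟨ cong (λ z → a * (a * (z + σ a)) * T s) b≡fa ⟩
        a * (a * (f a + σ a)) * T s
          ≡⟨ cong (λ z → a * z * T s) a*[fa+σa]≡σa ⟩
        a * σ a * T s ∎)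
      σs≡s² : σ s ≡ s * s
      σs≡s² = begin
        σ s               ≡⟨ solve 2 (λ σs s → σs := σs :+ s :+ s) refl (σ s) s ⟩
        σ s + s + s       ≡⟨ cong (_+ s) σs+s≡Ts ⟩
        s * s + s + s     ≡⟨ solve 1 (λ s → s :* s :+ s :+ s := s :* s) refl s ⟩
        s * s             ∎

    module WhenB≢fa (b≢fa : b ≢ f a) where

      e : Carrier
      e = a * (b + σ a) * σ a ⁻¹

      σ-equation : ∀ {x} → Solution x → σ (scale x) + scale x ≡ e * T (scale x)
      σ-equation {x} sol = *-cancelˡ aσa≢0 (begin
        a * σ a * (σ s + s)
          ≡⟨ scaled-equation sol ⟩
        a * a * (b + σ a) * T s
          ≡⟨ *-identityʳ _ ⟨
        a * a * (b + σ a) * T s * 1#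
          ≡⟨ cong (a * a * (b + σ a) * T s *_) (*-inverseʳ (σ-nonzero a≢0)) ⟨
        a * a * (b + σ a) * T s * (σ a * σ a ⁻¹)
          ≡⟨ solve 5 (λ a b sa i t → a :* a :* (b :+ sa) :* t :* (sa :* i)
                      := a :* sa :* (a :* (b :+ sa) :* i :* t)) refl a b (σ a) (σ a ⁻¹) (T s) ⟩
        a * σ a * (e * T s) ∎)
        where
        s : Carrier
        s = scale x

      T∘scale≢0 : ∀ {x} → Solution x → T (scale x) ≢ 0#
      T∘scale≢0 {x} sol Ts≡0 = b≢fa (trivial-solution⇒b≡fa sol (Sum.map s≡0⇒x≡0 s+1≡0⇒x≡a (x*y≡0⇒x≡0∨y≡0 s[s+1]≡0)))
        where
        s : Carrier
        s = scale x
        s[s+1]≡0 : s * (s + 1#) ≡ 0#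
        s[s+1]≡0 = trans (solve 1 (λ s → s :* (s :+ con true) := s :* s :+ s) refl s) Ts≡0
        s≡0⇒x≡0 : s ≡ 0# → x ≡ 0#
        s≡0⇒x≡0 s≡0 = scale-injective (trans s≡0 (sym (zeroˡ (a ⁻¹))))
        s+1≡0⇒x≡a : s + 1# ≡ 0# → x ≡ a
        s+1≡0⇒x≡a s+1≡0 = scale-injective (trans (x+y≡0⇒x≡y s+1≡0) (sym (*-inverseʳ a≢0)))

      T∘scale-fixed : ∀ {x} → Solution x → σ e * e * e * T (scale x) ≡ 1# + e + σ e * (1# + e)
      T∘scale-fixed sol = σ-equation-determines-T (σ-equation sol) (T∘scale≢0 sol)

      e≢0 : ∀ {x} → Solution x → e ≢ 0#
      e≢0 {x} sol e≡0 = 0≢1 (begin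
        0#
          ≡⟨ solve 1 (λ t → con false := con false :* con false :* con false :* t) refl (T (scale x)) ⟩
        0# * 0# * 0# * T (scale x)
          ≡⟨ cong (λ z → z * 0# * 0# * T (scale x)) (frob-0 k) ⟨
        σ 0# * 0# * 0# * T (scale x)
          ≡⟨ cong (λ z → σ z * z * z * T (scale x)) e≡0 ⟨
        σ e * e * e * T (scale x)
          ≡⟨ T∘scale-fixed sol ⟩
        1# + e + σ e * (1# + e)
          ≡⟨ cong (λ z → 1# + z + σ z * (1# + z)) e≡0 ⟩
        1# + 0# + σ 0# * (1# + 0#)
          ≡⟨ cong (λ z → 1# + 0# + z * (1# + 0#)) (frob-0 k) ⟩
        1# + 0# + 0# * (1# + 0#)
          ≡⟨ solve 0 (con true :+ con false :+ con false :* (con true :+ con false) := con true) refl ⟩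
        1# ∎)

      solutions-differ-by-0-or-1 : ∀ {x y} → Solution x → Solution y → scale y ≡ scale x ⊎ scale y ≡ scale x + 1#
      solutions-differ-by-0-or-1 sx sy = x²+x≡y²+y⇒y≡x∨y≡x+1 (*-cancelˡ c≢0 (trans (T∘scale-fixed sx) (sym (T∘scale-fixed sy))))
        where
        c≢0 : σ e * e * e ≢ 0#
        c≢0 = *-nonzero (*-nonzero (σ-nonzero (e≢0 sx)) (e≢0 sx)) (e≢0 sx)

    at-most-two : ∀ {x y z} → Solution x → Solution y → Solution z → x ≡ y ⊎ x ≡ z ⊎ y ≡ z
    at-most-two sx sy sz with b ≟ f a
    ... | yes b≡fa = pigeonhole (solution-when-b≡fa b≡fa sx) (solution-when-b≡fa b≡fa sy) (solution-when-b≡fa b≡fa sz)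
    ... | no b≢fa  = Sum.map scale-injective (Sum.map scale-injective scale-injective)
                       (pigeonhole (inj₁ refl) (solutions-differ-by-0-or-1 sx sy) (solutions-differ-by-0-or-1 sx sz))
      where open WhenB≢fa b≢fa

  isAPN : IsAPN f
  isAPN a b a≢0 = count-≤-2 (λ x → f (x + a) - f x ≟ b) (DerivativeSolutions.at-most-two a≢0 b)

  Q : Carrier → Carrier
  Q r = r * σ r

  Q∘f : ∀ x → Q (f x) ≡ x * (1# + x) * (1# + σ x)
  Q∘f x = begin
    f x * σ (f x)
      ≡⟨ cong (λ y → y * σ y) (f≡ρ*[1+x] x) ⟩
    ρ x * (1# + x) * σ (ρ x * (1# + x))
      ≡⟨ cong (ρ x * (1# + x) *_) σ[ρx*[1+x]] ⟩
    ρ x * (1# + x) * (σ (ρ x) * (1# + σ x))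
      ≡⟨ solve 4 (λ r x sr sx → r :* (con true :+ x) :* (sr :* (con true :+ sx))
                  := r :* sr :* (con true :+ x) :* (con true :+ sx)) refl (ρ x) x (σ (ρ x)) (σ x) ⟩
    τ (ρ x) * (1# + x) * (1# + σ x)
      ≡⟨ cong (λ y → y * (1# + x) * (1# + σ x)) (τ∘ρ≡id x) ⟩
    x * (1# + x) * (1# + σ x) ∎
    where
    σ[ρx*[1+x]] : σ (ρ x * (1# + x)) ≡ σ (ρ x) * (1# + σ x)
    σ[ρx*[1+x]] = trans (frob-* k (ρ x) (1# + x)) (cong (σ (ρ x) *_) (trans (frob-+ k 1# x) (cong (_+ σ x) (frob-1 k))))

  -- Q (f x) = (x + x²) + (x σ x + x² σ x), and x σ x and x² σ x = σ (x σ x) have the same trace.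
  Tr∘Q∘f≡0 : ∀ x → Tr (Q (f x)) ≡ 0#
  Tr∘Q∘f≡0 x = begin
    Tr (Q (f x))
      ≡⟨ cong Tr (trans (Q∘f x) (solve 2 (λ x sx → x :* (con true :+ x) :* (con true :+ sx)
                                          := (x :+ x :* x) :+ (x :* sx :+ x :* x :* sx)) refl x (σ x))) ⟩
    Tr ((x + x * x) + (x * σ x + x * x * σ x))
      ≡⟨ trans (Tr-+ _ _) (cong (Tr (x + x * x) +_) (Tr-+ _ _)) ⟩
    Tr (x + x * x) + (Tr (x * σ x) + Tr (x * x * σ x))
      ≡⟨ cong₂ _+_ (Tr-x+x² x) (x≡y⇒x+y≡0 Tr[xσx]≡Tr[x²σx]) ⟩
    0# + 0#
      ≡⟨ +-identityʳ 0# ⟩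
    0# ∎
    where
    Tr[xσx]≡Tr[x²σx] : Tr (x * σ x) ≡ Tr (x * x * σ x)
    Tr[xσx]≡Tr[x²σx] = begin
      Tr (x * σ x)              ≡⟨ Tr-frob k (x * σ x) ⟨
      Tr (σ (x * σ x))          ≡⟨ cong Tr (trans (frob-* k x (σ x)) (cong (σ x *_) (σ∘σ≡square x))) ⟩
      Tr (σ x * (x * x))        ≡⟨ cong Tr (*-comm (σ x) (x * x)) ⟩
      Tr (x * x * σ x)          ∎

  sqrt : Carrier → Carrier
  sqrt = frob (m ℕ.+ m)

  M : Carrier → Carrier
  M g = σ g + sqrt (σ g)

  Tr[g*σr]≡Tr[r*sqrt[σg]] : ∀ r g → Tr (g * σ r) ≡ Tr (r * sqrt (σ g))
  Tr[g*σr]≡Tr[r*sqrt[σg]] r g = begin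
    Tr (g * σ r)              ≡⟨ Tr-frob k (g * σ r) ⟨
    Tr (σ (g * σ r))          ≡⟨ cong Tr (frob-* k g (σ r)) ⟩
    Tr (σ g * σ (σ r))        ≡⟨ cong Tr (cong₂ _*_ (sym (frob-[1+n]≡id (σ g))) (σ∘σ≡square r)) ⟩
    Tr (h * h * (r * r))      ≡⟨ cong Tr (solve 2 (λ h r → h :* h :* (r :* r) := r :* h :* (r :* h)) refl h r) ⟩
    Tr (r * h * (r * h))      ≡⟨ Tr-square (r * h) ⟩
    Tr (r * h)                ∎
    where
    h : Carrier
    h = sqrt (σ g)

  Tr∘Q-+ : ∀ r g → Tr (Q (r + g)) ≡ Tr (Q r) + Tr (r * M g) + Tr (Q g)
  Tr∘Q-+ r g = begin
    Tr ((r + g) * σ (r + g))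
      ≡⟨ cong (λ z → Tr ((r + g) * z)) (frob-+ k r g) ⟩
    Tr ((r + g) * (σ r + σ g))
      ≡⟨ cong Tr (solve 4 (λ r g sr sg → (r :+ g) :* (sr :+ sg) := r :* sr :+ r :* sg :+ g :* sr :+ g :* sg)
                          refl r g (σ r) (σ g)) ⟩
    Tr (Q r + r * σ g + g * σ r + Q g)
      ≡⟨ trans (Tr-+ _ _) (cong (_+ Tr (Q g)) (trans (Tr-+ _ _) (cong (_+ Tr (g * σ r)) (Tr-+ _ _)))) ⟩
    Tr (Q r) + Tr (r * σ g) + Tr (g * σ r) + Tr (Q g)
      ≡⟨ cong (λ z → Tr (Q r) + Tr (r * σ g) + z + Tr (Q g)) (Tr[g*σr]≡Tr[r*sqrt[σg]] r g) ⟩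
    Tr (Q r) + Tr (r * σ g) + Tr (r * sqrt (σ g)) + Tr (Q g)
      ≡⟨ cong (_+ Tr (Q g)) (trans (+-assoc _ _ _) (cong (Tr (Q r) +_) (sym (Tr-+ _ _)))) ⟩
    Tr (Q r) + Tr (r * σ g + r * sqrt (σ g)) + Tr (Q g)
      ≡⟨ cong (λ z → Tr (Q r) + Tr z + Tr (Q g)) (distribˡ r (σ g) (sqrt (σ g))) ⟨
    Tr (Q r) + Tr (r * M g) + Tr (Q g) ∎

  Tr∘M≡0 : ∀ g → Tr (M g) ≡ 0#
  Tr∘M≡0 g = begin
    Tr (σ g + h)              ≡⟨ Tr-+ (σ g) h ⟩
    Tr (σ g) + Tr h           ≡⟨ cong (λ z → Tr z + Tr h) (frob-[1+n]≡id (σ g)) ⟨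
    Tr (h * h) + Tr h         ≡⟨ cong (_+ Tr h) (Tr-square h) ⟩
    Tr h + Tr h               ≡⟨ x+x≡0 (Tr h) ⟩
    0#                        ∎
    where
    h : Carrier
    h = sqrt (σ g)

  M1≡0 : M 1# ≡ 0#
  M1≡0 = trans (cong (λ z → z + sqrt z) (frob-1 k)) (trans (cong (1# +_) (frob-1 (m ℕ.+ m))) 1+1≡0)

  M-nonzero : ∀ {g} → g ≢ 0# → g ≢ 1# → M g ≢ 0#
  M-nonzero {g} g≢0 g≢1 Mg≡0 = [ (λ σg≡0 → g≢0 (σ-injective (trans σg≡0 (sym (frob-0 k)))))
                               , (λ σg≡1 → g≢1 (σ-injective (trans σg≡1 (sym (frob-1 k))))) ]′
                               (x²≡x⇒x≡0∨x≡1 σg²≡σg)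
    where
    σg²≡σg : σ g * σ g ≡ σ g
    σg²≡σg = trans (cong (λ z → z * z) (x+y≡0⇒x≡y Mg≡0)) (frob-[1+n]≡id (σ g))

  Tr1≡1 : Tr 1# ≡ 1#
  Tr1≡1 = tr-1-odd m

  Tr∘Q-+1 : ∀ r → Tr (Q (r + 1#)) ≡ Tr (Q r) + 1#
  Tr∘Q-+1 r = begin
    Tr (Q (r + 1#))                        ≡⟨ Tr∘Q-+ r 1# ⟩
    Tr (Q r) + Tr (r * M 1#) + Tr (Q 1#)   ≡⟨ cong₂ (λ y z → Tr (Q r) + y + z) Tr[r*M1]≡0 Tr[Q1]≡1 ⟩
    Tr (Q r) + 0# + 1#                     ≡⟨ cong (_+ 1#) (+-identityʳ (Tr (Q r))) ⟩
    Tr (Q r) + 1#                          ∎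
    where
    Tr[r*M1]≡0 : Tr (r * M 1#) ≡ 0#
    Tr[r*M1]≡0 = trans (cong (λ z → Tr (r * z)) M1≡0) (trans (cong Tr (zeroʳ r)) Tr-0)
    Tr[Q1]≡1 : Tr (Q 1#) ≡ 1#
    Tr[Q1]≡1 = trans (cong Tr (trans (cong (1# *_) (frob-1 k)) (*-identityʳ 1#))) Tr1≡1

  S : Pred Carrier 0ℓ
  S r = Tr (Q r) ≡ 0#

  S? : Decidable S
  S? r = Tr (Q r) ≟ 0#

  S-+1 : ∀ {r} → ¬ S r → S (r + 1#)
  S-+1 {r} ¬Sr = trans (Tr∘Q-+1 r) (trans (cong (_+ 1#) Tr∘Q≡1) 1+1≡0)
    where
    Tr∘Q≡1 : Tr (Q r) ≡ 1#
    Tr∘Q≡1 = [ (λ Sr → ⊥-elim (¬Sr Sr)) , id ]′ (Tr≡0∨Tr≡1 (Q r))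

  S⇒¬S-+1 : ∀ {r} → S r → ¬ S (r + 1#)
  S⇒¬S-+1 {r} Sr Sr+1 = 1≢0 (begin
    1#                      ≡⟨ +-identityˡ 1# ⟨
    0# + 1#                 ≡⟨ cong (_+ 1#) Sr ⟨
    Tr (Q r) + 1#           ≡⟨ Tr∘Q-+1 r ⟨
    Tr (Q (r + 1#))         ≡⟨ Sr+1 ⟩
    0#                      ∎)

  image≐S : Image f ≐ S
  image≐S = image⊆S , ⊆∧count≡⇒⊇ (image? f) S? image⊆S (m+m≡n+n⇒m≡n (trans count-image (sym count-S)))
    where
    image⊆S : Image f ⊆ S
    image⊆S (x , refl) = Tr∘Q∘f≡0 x
    count-S : count S? ℕ.+ count S? ≡ q
    count-S = trans (count-half S? (_+ 1#) x+1+1≡x S-+1 S⇒¬S-+1) length-elems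

  -- The predicate that diff? decides in IsRelDiffSet; counts of it are stated for an
  -- arbitrary decider because diff? itself is local to Defs.
  DifferencePair : Carrier → Pred (Carrier × Carrier) 0ℓ
  DifferencePair g p = Image f (proj₁ p) × Image f (proj₂ p) × proj₁ p ≢ proj₂ p × proj₁ p - proj₂ p ≡ g

  ImageShift : Carrier → Pred Carrier 0ℓ
  ImageShift g r = Image f r × Image f (r + g)

  imageShift? : ∀ g → Decidable (ImageShift g)
  imageShift? g = image? f ∩? (image? f ∘ (_+ g))

  count₂-DifferencePair : ∀ {g} → g ≢ 0# → (D? : Decidable (DifferencePair g)) → count₂ D? ≡ count (imageShift? g)
  count₂-DifferencePair {g} g≢0 D? =
    trans (Pairs.count-≡-length D? (Unique.map⁺ (cong proj₁) (Unique.filter⁺ (imageShift? g) elems-unique)) (mk⇔ to from))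
          (length-map pair (filter (imageShift? g) elems))
    where
    pair : Carrier → Carrier × Carrier
    pair r = r , r + g
    r-[r+g]≡g : ∀ r → r - (r + g) ≡ g
    r-[r+g]≡g r = trans (cong (r +_) (-x≡x (r + g))) (solve 2 (λ r g → r :+ (r :+ g) := g) refl r g)
    r≢r+g : ∀ r → r ≢ r + g
    r≢r+g r r≡r+g = g≢0 (begin
      g              ≡⟨ r-[r+g]≡g r ⟨
      r - (r + g)    ≡⟨ cong (λ z → r - z) r≡r+g ⟨
      r - r          ≡⟨ -‿inverseʳ r ⟩
      0#             ∎)
    to : ∀ {p} → p ∈ map pair (filter (imageShift? g) elems) → DifferencePair g p
    to p∈ with ∈-map⁻ pair p∈
    ... | r , r∈ , refl with proj₂ (∈-filter⁻ (imageShift? g) {xs = elems} r∈)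
    ... | Ir , Ir+g = Ir , Ir+g , r≢r+g r , r-[r+g]≡g r
    from : ∀ {p} → DifferencePair g p → p ∈ map pair (filter (imageShift? g) elems)
    from {r , r′} (Ir , Ir′ , _ , r-r′≡g) =
      subst (λ z → (r , z) ∈ map pair (filter (imageShift? g) elems)) (sym r′≡r+g)
            (∈-map⁺ pair (∈-filter⁺ (imageShift? g) (elems-complete r) (Ir , subst (Image f) r′≡r+g Ir′)))
      where
      r′≡r+g : r′ ≡ r + g
      r′≡r+g = begin
        r′               ≡⟨ solve 2 (λ r r′ → r′ := r :+ (r :+ r′)) refl r r′ ⟩
        r + (r + r′)     ≡⟨ cong (λ z → r + (r + z)) (-x≡x r′) ⟨
        r + (r - r′)     ≡⟨ cong (r +_) r-r′≡g ⟩
        r + g            ∎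

  count₂-DifferencePair-in-N₀₁ : ∀ {g} → N₀₁ g → g ≢ 0# → (D? : Decidable (DifferencePair g)) → count₂ D? ≡ 0
  count₂-DifferencePair-in-N₀₁ (inj₁ g≡0) g≢0 _  = ⊥-elim (g≢0 g≡0)
  count₂-DifferencePair-in-N₀₁ (inj₂ refl) _  D? = trans (count₂-DifferencePair 1≢0 D?)
    (count-≡0 (imageShift? 1#) (λ r (Ir , Ir+1) → S⇒¬S-+1 (proj₁ image≐S Ir) (proj₁ image≐S Ir+1)))

  -- For r in S, r + g lies in S exactly when Tr (r * M g) = Tr (Q g): a hyperplane
  -- condition (M g ≠ 0) which the translation r ↦ r + 1 preserves while leaving S.
  module DifferenceOutsideN₀₁ {g : Carrier} (g≢0 : g ≢ 0#) (g≢1 : g ≢ 1#) where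

    Z : Pred Carrier 0ℓ
    Z r = Tr (r * M g) ≡ Tr (Q g)

    Z? : Decidable Z
    Z? r = Tr (r * M g) ≟ Tr (Q g)

    Tr[[r+c]*Mg] : ∀ r c → Tr ((r + c) * M g) ≡ Tr (r * M g) + Tr (c * M g)
    Tr[[r+c]*Mg] r c = trans (cong Tr (distribʳ (M g) r c)) (Tr-+ (r * M g) (c * M g))

    Z-+1 : ∀ {r} → Z r → Z (r + 1#)
    Z-+1 {r} Zr = begin
      Tr ((r + 1#) * M g)              ≡⟨ Tr[[r+c]*Mg] r 1# ⟩
      Tr (r * M g) + Tr (1# * M g)     ≡⟨ cong (λ z → Tr (r * M g) + Tr z) (*-identityˡ (M g)) ⟩
      Tr (r * M g) + Tr (M g)          ≡⟨ cong (Tr (r * M g) +_) (Tr∘M≡0 g) ⟩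
      Tr (r * M g) + 0#                ≡⟨ +-identityʳ _ ⟩
      Tr (r * M g)                     ≡⟨ Zr ⟩
      Tr (Q g)                         ∎

    Tr[[r+M⁻¹]*M] : ∀ r → Tr ((r + M g ⁻¹) * M g) ≡ Tr (r * M g) + 1#
    Tr[[r+M⁻¹]*M] r = trans (Tr[[r+c]*Mg] r (M g ⁻¹))
      (trans (cong (λ z → Tr (r * M g) + Tr z) (*-inverseˡ (M-nonzero g≢0 g≢1))) (cong (Tr (r * M g) +_) Tr1≡1))

    count-Z : count Z? ℕ.+ count Z? ≡ q
    count-Z = trans (count-half Z? (_+ M g ⁻¹) (λ r → solve 2 (λ r i → r :+ i :+ i := r) refl r (M g ⁻¹)) ¬Z-flip Z-flip) length-elems
      where
      ¬Z-flip : ∀ {r} → ¬ Z r → Z (r + M g ⁻¹)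
      ¬Z-flip {r} ¬Zr = trans (Tr[[r+M⁻¹]*M] r) (Tr≢Tr⇒Tr+1≡Tr ¬Zr)
      Z-flip : ∀ {r} → Z r → ¬ Z (r + M g ⁻¹)
      Z-flip {r} Zr Zr+M⁻¹ = x+1≢x (Tr (r * M g)) (trans (sym (Tr[[r+M⁻¹]*M] r)) (trans Zr+M⁻¹ (sym Zr)))

    count-Z∩S : count (Z? ∩? S?) ℕ.+ count (Z? ∩? S?) ≡ count Z?
    count-Z∩S = count-half-of Z? S? (_+ 1#) x+1+1≡x Z-+1 S-+1 S⇒¬S-+1

    imageShift≐Z∩S : ImageShift g ≐ (Z ∩ S)
    imageShift≐Z∩S = (λ (Ir , Ir+g) → Equivalence.to (S⇒[S[r+g]⇔Z] (image⊆S Ir)) (image⊆S Ir+g) , image⊆S Ir)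
                   , (λ (Zr , Sr) → S⊆image Sr , S⊆image (Equivalence.from (S⇒[S[r+g]⇔Z] Sr) Zr))
      where
      image⊆S : Image f ⊆ S
      image⊆S = proj₁ image≐S
      S⊆image : S ⊆ Image f
      S⊆image = proj₂ image≐S
      S⇒[S[r+g]⇔Z] : ∀ {r} → S r → S (r + g) ⇔ Z r
      S⇒[S[r+g]⇔Z] {r} Sr = mk⇔ (λ Sr+g → x+y≡0⇒x≡y (trans (sym shift) Sr+g)) (λ Zr → trans shift (x≡y⇒x+y≡0 Zr))
        where
        shift : Tr (Q (r + g)) ≡ Tr (r * M g) + Tr (Q g)
        shift = trans (Tr∘Q-+ r g) (trans (cong (λ z → z + Tr (r * M g) + Tr (Q g)) Sr) (cong (_+ Tr (Q g)) (+-identityˡ _)))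

    count₂-DifferencePair-quarter : (D? : Decidable (DifferencePair g)) →
                                    let c = count₂ D? in (c ℕ.+ c) ℕ.+ (c ℕ.+ c) ≡ q
    count₂-DifferencePair-quarter D? = trans (cong (λ c → (c ℕ.+ c) ℕ.+ (c ℕ.+ c)) count₂≡count[Z∩S])
                                             (trans (cong₂ ℕ._+_ count-Z∩S count-Z∩S) count-Z)
      where
      count₂≡count[Z∩S] : count₂ D? ≡ count (Z? ∩? S?)
      count₂≡count[Z∩S] = trans (count₂-DifferencePair g≢0 D?) (count-cong (imageShift? g) (Z? ∩? S?) imageShift≐Z∩S)

  count₂-DifferencePair-outside-N₀₁ : ∀ {g} → ¬ N₀₁ g → (D? : Decidable (DifferencePair g)) →
                                      let c = count₂ D? in (c ℕ.+ c) ℕ.+ (c ℕ.+ c) ≡ q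
  count₂-DifferencePair-outside-N₀₁ g∉N₀₁ = DifferenceOutsideN₀₁.count₂-DifferencePair-quarter (g∉N₀₁ ∘ inj₁) (g∉N₀₁ ∘ inj₂)

m+m≡2^[1+e]⇒m≡2^e : ∀ {m} e → m ℕ.+ m ≡ 2 ℕ.^ suc e → m ≡ 2 ℕ.^ e
m+m≡2^[1+e]⇒m≡2^e e m+m≡2^[1+e] =
  m+m≡n+n⇒m≡n (trans m+m≡2^[1+e] (cong (2 ℕ.^ e ℕ.+_) (ℕₚ.+-identityʳ (2 ℕ.^ e))))

open import Data.Nat using (_^_; _*_)
open FiniteField using (IsTwoToOne; IsAPN; IsRelDiffSet; Image; image?; N₀₁; N₀₁?)

mainTheorem7 : (k : ℕ) → 2 ≤ k → (F : FiniteField (2 ^ (2 * k ∸ 1))) →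
    IsTwoToOne F (f₇ F k)
    × IsAPN F (f₇ F k)
    × IsRelDiffSet F (2 ^ (2 * k ∸ 2)) 2 (2 ^ (2 * k ∸ 2)) (2 ^ (2 * k ∸ 3))
        (Image F (f₇ F k)) (image? F (f₇ F k)) (N₀₁ F) (N₀₁? F)
mainTheorem7 k@(suc (suc j)) (s≤s (s≤s z≤n)) F =
    isTwoToOne
  , isAPN
  , ( ℕₚ.*-comm (2 ^ (2 * k ∸ 2)) 2
    , count-N₀₁
    , m+m≡2^[1+e]⇒m≡2^e (2 * k ∸ 2) count-image
    , (λ _ g∉N₀₁ → quarter (count₂-DifferencePair-outside-N₀₁ g∉N₀₁ _))
    , (λ _ g∈N₀₁ g≢0 → count₂-DifferencePair-in-N₀₁ g∈N₀₁ g≢0 _) )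
  where
  2k∸2≡2[1+j] : 2 * k ∸ 2 ≡ suc j ℕ.+ suc j
  2k∸2≡2[1+j] = trans (ℕₚ.+-suc j (suc (j ℕ.+ 0))) (cong (λ n → suc (j ℕ.+ suc n)) (ℕₚ.+-identityʳ j))

  2k∸2≡1+[2k∸3] : 2 * k ∸ 2 ≡ suc (2 * k ∸ 3)
  2k∸2≡1+[2k∸3] = trans (ℕₚ.+-suc j (suc (j ℕ.+ 0))) (cong (λ n → suc (n ∸ 1)) (sym (ℕₚ.+-suc j (suc (j ℕ.+ 0)))))

  quarter : ∀ {c} → (c ℕ.+ c) ℕ.+ (c ℕ.+ c) ≡ 2 ^ (2 * k ∸ 1) → c ≡ 2 ^ (2 * k ∸ 3)
  quarter 4c≡q = m+m≡2^[1+e]⇒m≡2^e (2 * k ∸ 3)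
    (trans (m+m≡2^[1+e]⇒m≡2^e (2 * k ∸ 2) 4c≡q) (cong (2 ^_) 2k∸2≡1+[2k∸3]))

  open f₇-Properties (suc j) F (cong (λ e → 2 ^ suc e) 2k∸2≡2[1+j])
    using (isTwoToOne; isAPN; count-image; count₂-DifferencePair-outside-N₀₁; count₂-DifferencePair-in-N₀₁)
  open FiniteFieldProperties F using (count-N₀₁)
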